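{- Let $(\mathsf T,\mu,\eta,\mathsf n,\mathsf n_K)$ be a symmetric comonoidal monad and $(!,\delta,\varepsilon,\Delta,\mathsf e,\mathsf m,\mathsf m_K)$ a monoidal coalgebra modality on the same symmetric monoidal category $(\mathbb X,\otimes,K)$. Then the following are in bijective correspondence: (1) symmetric monoidal mixed distributive laws of $(\mathsf T,\mu,\eta,\mathsf n,\mathsf n_K)$ over $(!,\delta,\varepsilon,\mathsf m,\mathsf m_K)$; (2) liftings of the monoidal coalgebra modality to $(\mathbb X^{\mathsf T},\otimes^{\mathsf n},(K,\mathsf n_K))$, i.e. monoidal coalgebra modalities $(\tilde!,\tilde\delta,\tilde\varepsilon,\tilde\Delta,\tilde{\mathsf e},\tilde{\mathsf m},\tilde{\mathsf m}_{(K,\mathsf n_K)})$ on $(\mathbb X^{\mathsf T},\otimes^{\mathsf n},(K,\mathsf n_K))$ with $U^{\mathsf T}\tilde!=!\,U^{\mathsf T}$ and such that for all $\mathsf T$-algebras $(A,\nu),(B,\nu')$ the forgetful functor $U^{\mathsf T}$ sends $\tilde\delta_{(A,\nu)},\tilde\varepsilon_{(A,\nu)},\tilde\Delta_{(A,\nu)},\tilde{\mathsf e}_{(A,\nu)},\tilde{\mathsf m}_{(A,\nu),(B,\nu')},\tilde{\mathsf m}_{(K,\mathsf n_K)}$ to $\delta_A,\varepsilon_A,\Delta_A,\mathsf e_A,\mathsf m_{A,B},\mathsf m_K$; (3) liftings of the symmetric comonoidal monad to $(\mathbb X^!,\otimes^{\mathsf m},(K,\mathsf m_K))$, i.e. symmetric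 comonoidal monads $(\tilde{\mathsf T},\tilde\mu,\tilde\eta,\tilde{\mathsf n},\tilde{\mathsf n}_{(K,\mathsf m_K)})$ on $(\mathbb X^!,\otimes^{\mathsf m},(K,\mathsf m_K))$ with $U^!\tilde{\mathsf T}=\mathsf T\,U^!$ and such that for all $!$-coalgebras $(A,\omega),(B,\omega')$ the forgetful functor $U^!$ sends $\tilde\mu_{(A,\omega)},\tilde\eta_{(A,\omega)},\tilde{\mathsf n}_{(A,\omega),(B,\omega')},\tilde{\mathsf n}_{(K,\mathsf m_K)}$ to $\mu_A,\eta_A,\mathsf n_{A,B},\mathsf n_K$.
   Context: Composition is written $g\circ f$; $(\mathbb X,\otimes,K)$ is symmetric monoidal with associator $\alpha$, unitors $\ell,\rho$, symmetry $\sigma$, interchange iso $\tau_{A,B,C,D}:(A\otimes B)\otimes(C\otimes D)\to(A\otimes C)\otimes(B\otimes D)$. Symmetric comonoidal monad $(\mathsf T,\mu,\eta,\mathsf n,\mathsf n_K)$: monad with natural $\mathsf n_{A,B}:\mathsf T(A\otimes B)\to\mathsf TA\otimes\mathsf TB$, map $\mathsf n_K:\mathsf TK\to K$ making $\mathsf T$ symmetric comonoidal, with $\mathsf n_{A,B}\circ\mu_{A\otimes B}=(\mu_A\otimes\mu_B)\circ\mathsf n_{\mathsf TA,\mathsf TB}\circ\mathsf T(\mathsf n_{A,B})$, $\mathsf n_K\circ\mu_K=\mathsf n_K\circ\mathsf T(\mathsf n_K)$, $\mathsf n_{A,B}\circ\eta_{A\otimes B}=\eta_A\otimes\eta_B$,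 $\mathsf n_K\circ\eta_K=1_K$. $\mathbb X^{\mathsf T}$ (algebras, forgetful $U^{\mathsf T}$) is symmetric monoidal with $(A,\nu)\otimes^{\mathsf n}(B,\nu')=(A\otimes B,(\nu\otimes\nu')\circ\mathsf n_{A,B})$, unit $(K,\mathsf n_K)$. Symmetric monoidal comonad $(!,\delta,\varepsilon,\mathsf m,\mathsf m_K)$: comonad with lax symmetric monoidal structure $\mathsf m_{A,B}:!A\otimes!B\to!(A\otimes B)$, $\mathsf m_K:K\to!K$ with $\delta,\varepsilon$ monoidal transformations. $\mathbb X^!$ (coalgebras, forgetful $U^!$) is symmetric monoidal with $(A,\omega)\otimes^{\mathsf m}(B,\omega')=(A\otimes B,\mathsf m_{A,B}\circ(\omega\otimes\omega'))$, unit $(K,\mathsf m_K)$. Monoidal coalgebra modality: a symmetric monoidal comonad with natural $\Delta_A:!A\to!A\otimes!A$, $\mathsf e_A:!A\to K$ making each $!A$ a cocommutative comonoid with $\delta_A$ a comonoid morphism, such that $\Delta_{A\otimes B}\circ\mathsf m_{A,B}=(\mathsf m_{A,B}\otimes\mathsf m_{A,B})\circ\tau\circ(\Delta_A\otimes\Delta_B)$, $\mathsf e_{A\otimes B}\circ\mathsf m_{A,B}=\ell_K\circ(\mathsf e_A\otimes\mathsf e_B)$, $\Delta_K\circ\mathsf m_K=(\mathsf m_K\otimes\mathsf m_K)\circ\ell_K^{ -1}$, $\mathsf e_K\circ\mathsf m_K=1_K$, $!(\Delta_A)\circ\delta_A=\mathsf m_{!A,!A}\circ(\delta_A\otimes\delta_A)\circ\Delta_A$,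 $!(\mathsf e_A)\circ\delta_A=\mathsf m_K\circ\mathsf e_A$. Mixed distributive law of $(\mathsf T,\mu,\eta)$ over $(!,\delta,\varepsilon)$: natural $\lambda_A:\mathsf T!A\to!\mathsf TA$ with $\lambda_A\circ\mu_{!A}=!(\mu_A)\circ\lambda_{\mathsf TA}\circ\mathsf T(\lambda_A)$, $\lambda_A\circ\eta_{!A}=!(\eta_A)$, $\delta_{\mathsf TA}\circ\lambda_A=!(\lambda_A)\circ\lambda_{!A}\circ\mathsf T(\delta_A)$, $\varepsilon_{\mathsf TA}\circ\lambda_A=\mathsf T(\varepsilon_A)$. Symmetric monoidal mixed distributive law: additionally $!(\mathsf n_{A,B})\circ\lambda_{A\otimes B}\circ\mathsf T(\mathsf m_{A,B})=\mathsf m_{\mathsf TA,\mathsf TB}\circ(\lambda_A\otimes\lambda_B)\circ\mathsf n_{!A,!B}$ and $!(\mathsf n_K)\circ\lambda_K\circ\mathsf T(\mathsf m_K)=\mathsf m_K\circ\mathsf n_K$. -}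

module Defs where

open import Level using (Level; _⊔_) renaming (suc to lsuc)
open import Relation.Binary using (IsEquivalence; Setoid)
open import Data.Product using (Σ; _×_; _,_; proj₁; proj₂)
import Relation.Binary.Reasoning.Setoid as SetoidR

record Category (o ℓ e : Level) : Set (lsuc (o ⊔ ℓ ⊔ e)) where
  infixr 9 _∘_
  infix  4 _≈_ _⇒_
  field
    Obj : Set o
    _⇒_ : Obj → Obj → Set ℓ
    _≈_ : ∀ {A B} → A ⇒ B → A ⇒ B → Set e
    id  : ∀ {A} → A ⇒ A
    _∘_ : ∀ {A B C} → B ⇒ C → A ⇒ B → A ⇒ C
    equiv     : ∀ {A B} → IsEquivalence (_≈_ {A} {B})
    ∘-resp-≈  : ∀ {A B C} {f h : B ⇒ C} {g i : A ⇒ B} → f ≈ h → g ≈ i → f ∘ g ≈ h ∘ i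
    identityˡ : ∀ {A B} {f : A ⇒ B} → id ∘ f ≈ f
    identityʳ : ∀ {A B} {f : A ⇒ B} → f ∘ id ≈ f
    assoc     : ∀ {A B C D} {f : A ⇒ B} {g : B ⇒ C} {h : C ⇒ D} →
                (h ∘ g) ∘ f ≈ h ∘ (g ∘ f)

  hom-setoid : ∀ {A B} → Setoid ℓ e
  hom-setoid {A} {B} = record { Carrier = A ⇒ B ; _≈_ = _≈_ ; isEquivalence = equiv }

  module _ {A B : Obj} where
    open IsEquivalence (equiv {A} {B}) public
      renaming (refl to ≈-refl; sym to ≈-sym; trans to ≈-trans)

  module HomReasoning {A B : Obj} = SetoidR (hom-setoid {A} {B})

  infixr 4 _⟩∘⟨_
  _⟩∘⟨_ : ∀ {A B C} {f h : B ⇒ C} {g i : A ⇒ B} → f ≈ h → g ≈ i → f ∘ g ≈ h ∘ i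
  _⟩∘⟨_ = ∘-resp-≈

  sym-assoc : ∀ {A B C D} {f : A ⇒ B} {g : B ⇒ C} {h : C ⇒ D} →
              h ∘ (g ∘ f) ≈ (h ∘ g) ∘ f
  sym-assoc = ≈-sym assoc

  infixr 4 refl⟩∘⟨_
  infixl 5 _⟩∘⟨refl
  refl⟩∘⟨_ : ∀ {A B C} {f : B ⇒ C} {g i : A ⇒ B} → g ≈ i → f ∘ g ≈ f ∘ i
  refl⟩∘⟨ p = ∘-resp-≈ ≈-refl p
  _⟩∘⟨refl : ∀ {A B C} {f h : B ⇒ C} {g : A ⇒ B} → f ≈ h → f ∘ g ≈ h ∘ g
  p ⟩∘⟨refl = ∘-resp-≈ p ≈-refl

record Functor {o ℓ e o′ ℓ′ e′} (C : Category o ℓ e) (D : Category o′ ℓ′ e′)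
       : Set (o ⊔ ℓ ⊔ e ⊔ o′ ⊔ ℓ′ ⊔ e′) where
  private
    module C = Category C
    module D = Category D
  field
    F₀ : C.Obj → D.Obj
    F₁ : ∀ {A B} → A C.⇒ B → F₀ A D.⇒ F₀ B
    identity     : ∀ {A} → F₁ (C.id {A}) D.≈ D.id
    homomorphism : ∀ {A B C} {f : A C.⇒ B} {g : B C.⇒ C} →
                   F₁ (g C.∘ f) D.≈ F₁ g D.∘ F₁ f
    F-resp-≈     : ∀ {A B} {f g : A C.⇒ B} → f C.≈ g → F₁ f D.≈ F₁ g

record SymMonoidal {o ℓ e} (𝒞 : Category o ℓ e) : Set (o ⊔ ℓ ⊔ e) where
  open Category 𝒞
  infixr 10 _⊗₀_ _⊗₁_
  field
    _⊗₀_ : Obj → Obj → Obj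
    _⊗₁_ : ∀ {A B C D} → A ⇒ B → C ⇒ D → (A ⊗₀ C) ⇒ (B ⊗₀ D)
    ⊗-id   : ∀ {A B} → id {A} ⊗₁ id {B} ≈ id
    ⊗-∘    : ∀ {A B C D E F} {f : B ⇒ C} {g : A ⇒ B} {h : E ⇒ F} {i : D ⇒ E} →
             (f ∘ g) ⊗₁ (h ∘ i) ≈ (f ⊗₁ h) ∘ (g ⊗₁ i)
    ⊗-resp : ∀ {A B C D} {f g : A ⇒ B} {h i : C ⇒ D} → f ≈ g → h ≈ i → f ⊗₁ h ≈ g ⊗₁ i
    K : Obj
    α   : ∀ {A B C} → (A ⊗₀ B) ⊗₀ C ⇒ A ⊗₀ (B ⊗₀ C)
    α⁻¹ : ∀ {A B C} → A ⊗₀ (B ⊗₀ C) ⇒ (A ⊗₀ B) ⊗₀ C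
    α-isoˡ : ∀ {A B C} → α⁻¹ ∘ α {A} {B} {C} ≈ id
    α-isoʳ : ∀ {A B C} → α ∘ α⁻¹ {A} {B} {C} ≈ id
    α-nat  : ∀ {A B C D E F} {f : A ⇒ B} {g : C ⇒ D} {h : E ⇒ F} →
             α ∘ ((f ⊗₁ g) ⊗₁ h) ≈ (f ⊗₁ (g ⊗₁ h)) ∘ α
    lu   : ∀ {A} → K ⊗₀ A ⇒ A
    lu⁻¹ : ∀ {A} → A ⇒ K ⊗₀ A
    lu-isoˡ : ∀ {A} → lu⁻¹ ∘ lu {A} ≈ id
    lu-isoʳ : ∀ {A} → lu ∘ lu⁻¹ {A} ≈ id
    lu-nat  : ∀ {A B} {f : A ⇒ B} → lu ∘ (id ⊗₁ f) ≈ f ∘ lu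
    ru   : ∀ {A} → A ⊗₀ K ⇒ A
    ru⁻¹ : ∀ {A} → A ⇒ A ⊗₀ K
    ru-isoˡ : ∀ {A} → ru⁻¹ ∘ ru {A} ≈ id
    ru-isoʳ : ∀ {A} → ru ∘ ru⁻¹ {A} ≈ id
    ru-nat  : ∀ {A B} {f : A ⇒ B} → ru ∘ (f ⊗₁ id) ≈ f ∘ ru
    σ : ∀ {A B} → A ⊗₀ B ⇒ B ⊗₀ A
    σ-nat : ∀ {A B C D} {f : A ⇒ B} {g : C ⇒ D} → σ ∘ (f ⊗₁ g) ≈ (g ⊗₁ f) ∘ σ
    σ-inv : ∀ {A B} → σ {B} {A} ∘ σ {A} {B} ≈ id
    pentagon : ∀ {A B C D} →
      (id {A} ⊗₁ α {B} {C} {D}) ∘ α ∘ (α ⊗₁ id) ≈ α ∘ α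
    triangle : ∀ {A B} → (id {A} ⊗₁ lu {B}) ∘ α ≈ ru ⊗₁ id
    hexagon  : ∀ {A B C} →
      (id {B} ⊗₁ σ {A} {C}) ∘ α ∘ (σ ⊗₁ id) ≈ α ∘ σ ∘ α

  τ : ∀ {A B C D} → (A ⊗₀ B) ⊗₀ (C ⊗₀ D) ⇒ (A ⊗₀ C) ⊗₀ (B ⊗₀ D)
  τ = α⁻¹ ∘ (id ⊗₁ (α ∘ ((σ ⊗₁ id) ∘ α⁻¹))) ∘ α

record SymMonCat (o ℓ e : Level) : Set (lsuc (o ⊔ ℓ ⊔ e)) where
  field
    cat : Category o ℓ e
    mon : SymMonoidal cat
  open Category cat public
  open SymMonoidal mon public

module _ {o ℓ r} (X : SymMonCat o ℓ r) where
  open SymMonCat X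

  record SCMData : Set (o ⊔ ℓ ⊔ r) where
    field
      T  : Functor cat cat
    open Functor T public renaming (F₀ to T₀; F₁ to T₁)
    field
      μ  : ∀ {A} → T₀ (T₀ A) ⇒ T₀ A
      η  : ∀ {A} → A ⇒ T₀ A
      n  : ∀ {A B} → T₀ (A ⊗₀ B) ⇒ T₀ A ⊗₀ T₀ B
      nK : T₀ K ⇒ K

  record IsSCM (D : SCMData) : Set (o ⊔ ℓ ⊔ r) where
    open SCMData D
    field
      μ-nat   : ∀ {A B} {f : A ⇒ B} → μ ∘ T₁ (T₁ f) ≈ T₁ f ∘ μ
      η-nat   : ∀ {A B} {f : A ⇒ B} → η ∘ f ≈ T₁ f ∘ η
      μ-assoc : ∀ {A} → μ {A} ∘ T₁ μ ≈ μ ∘ μ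
      μ-unitˡ : ∀ {A} → μ {A} ∘ η ≈ id
      μ-unitʳ : ∀ {A} → μ {A} ∘ T₁ η ≈ id
      n-nat : ∀ {A B C D} {f : A ⇒ B} {g : C ⇒ D} →
              n ∘ T₁ (f ⊗₁ g) ≈ (T₁ f ⊗₁ T₁ g) ∘ n
      n-α   : ∀ {A B C} → α ∘ (n ⊗₁ id) ∘ n ≈ (id ⊗₁ n) ∘ n ∘ T₁ (α {A} {B} {C})
      n-lu  : ∀ {A} → lu ∘ (nK ⊗₁ id) ∘ n ≈ T₁ (lu {A})
      n-ru  : ∀ {A} → ru ∘ (id ⊗₁ nK) ∘ n ≈ T₁ (ru {A})
      n-σ   : ∀ {A B} → σ ∘ n ≈ n ∘ T₁ (σ {A} {B})
      μ-n  : ∀ {A B} → n {A} {B} ∘ μ ≈ (μ ⊗₁ μ) ∘ n ∘ T₁ n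
      μ-nK : nK ∘ μ ≈ nK ∘ T₁ nK
      η-n  : ∀ {A B} → n {A} {B} ∘ η ≈ η ⊗₁ η
      η-nK : nK ∘ η ≈ id

  record SymComonoidalMonad : Set (o ⊔ ℓ ⊔ r) where
    field
      dat   : SCMData
      isSCM : IsSCM dat
    open SCMData dat public
    open IsSCM isSCM public

  record MCMData : Set (o ⊔ ℓ ⊔ r) where
    field
      Bang : Functor cat cat
    open Functor Bang public renaming (F₀ to !₀; F₁ to !₁)
    field
      δ  : ∀ {A} → !₀ A ⇒ !₀ (!₀ A)
      ε  : ∀ {A} → !₀ A ⇒ A
      m  : ∀ {A B} → !₀ A ⊗₀ !₀ B ⇒ !₀ (A ⊗₀ B)
      mK : K ⇒ !₀ K
      Δ  : ∀ {A} → !₀ A ⇒ !₀ A ⊗₀ !₀ A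
      e  : ∀ {A} → !₀ A ⇒ K

  record IsMCM (D : MCMData) : Set (o ⊔ ℓ ⊔ r) where
    open MCMData D
    field
      δ-nat : ∀ {A B} {f : A ⇒ B} → δ ∘ !₁ f ≈ !₁ (!₁ f) ∘ δ
      ε-nat : ∀ {A B} {f : A ⇒ B} → ε ∘ !₁ f ≈ f ∘ ε
      δ-assoc : ∀ {A} → !₁ δ ∘ δ {A} ≈ δ ∘ δ
      δ-unitˡ : ∀ {A} → ε ∘ δ {A} ≈ id
      δ-unitʳ : ∀ {A} → !₁ ε ∘ δ {A} ≈ id
      m-nat : ∀ {A B C D} {f : A ⇒ B} {g : C ⇒ D} →
              m ∘ (!₁ f ⊗₁ !₁ g) ≈ !₁ (f ⊗₁ g) ∘ m
      m-α   : ∀ {A B C} → m ∘ (id ⊗₁ m) ∘ α ≈ !₁ (α {A} {B} {C}) ∘ m ∘ (m ⊗₁ id)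
      m-lu  : ∀ {A} → !₁ (lu {A}) ∘ m ∘ (mK ⊗₁ id) ≈ lu
      m-ru  : ∀ {A} → !₁ (ru {A}) ∘ m ∘ (id ⊗₁ mK) ≈ ru
      m-σ   : ∀ {A B} → m ∘ σ ≈ !₁ (σ {A} {B}) ∘ m
      δ-m  : ∀ {A B} → δ ∘ m {A} {B} ≈ !₁ m ∘ m ∘ (δ ⊗₁ δ)
      δ-mK : δ ∘ mK ≈ !₁ mK ∘ mK
      ε-m  : ∀ {A B} → ε ∘ m {A} {B} ≈ ε ⊗₁ ε
      ε-mK : ε ∘ mK ≈ id
      Δ-nat : ∀ {A B} {f : A ⇒ B} → Δ ∘ !₁ f ≈ (!₁ f ⊗₁ !₁ f) ∘ Δ
      e-nat : ∀ {A B} {f : A ⇒ B} → e ∘ !₁ f ≈ e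
      Δ-coassoc : ∀ {A} → α ∘ (Δ ⊗₁ id) ∘ Δ {A} ≈ (id ⊗₁ Δ) ∘ Δ
      Δ-counitˡ : ∀ {A} → lu ∘ (e ⊗₁ id) ∘ Δ {A} ≈ id
      Δ-counitʳ : ∀ {A} → ru ∘ (id ⊗₁ e) ∘ Δ {A} ≈ id
      Δ-cocomm  : ∀ {A} → σ ∘ Δ {A} ≈ Δ
      δ-Δ : ∀ {A} → Δ ∘ δ {A} ≈ (δ ⊗₁ δ) ∘ Δ
      δ-e : ∀ {A} → e ∘ δ {A} ≈ e
      Δ-m  : ∀ {A B} → Δ ∘ m {A} {B} ≈ (m ⊗₁ m) ∘ τ ∘ (Δ ⊗₁ Δ)
      e-m  : ∀ {A B} → e ∘ m {A} {B} ≈ lu ∘ (e ⊗₁ e)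
      Δ-mK : Δ ∘ mK ≈ (mK ⊗₁ mK) ∘ lu⁻¹
      e-mK : e ∘ mK ≈ id
      !Δ-δ : ∀ {A} → !₁ Δ ∘ δ {A} ≈ m ∘ (δ ⊗₁ δ) ∘ Δ
      !e-δ : ∀ {A} → !₁ e ∘ δ {A} ≈ mK ∘ e

  record MonoidalCoalgebraModality : Set (o ⊔ ℓ ⊔ r) where
    field
      dat   : MCMData
      isMCM : IsMCM dat
    open MCMData dat public
    open IsMCM isMCM public

module SMCProps {o ℓ r} (X : SymMonCat o ℓ r) where
  open SymMonCat X

  split-l : ∀ {A B C D E} {f : B ⇒ C} {g : A ⇒ B} {h : D ⇒ E} →
            (f ∘ g) ⊗₁ h ≈ (f ⊗₁ h) ∘ (g ⊗₁ id)
  split-l = ≈-trans (⊗-resp ≈-refl (≈-sym identityʳ)) ⊗-∘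

  split-r : ∀ {A B C D E} {f : A ⇒ B} {g : D ⇒ E} {h : C ⇒ D} →
            f ⊗₁ (g ∘ h) ≈ (f ⊗₁ g) ∘ (id ⊗₁ h)
  split-r = ≈-trans (⊗-resp (≈-sym identityʳ) ≈-refl) ⊗-∘

  split-l′ : ∀ {A B C D E} {f : B ⇒ C} {g : A ⇒ B} {h : D ⇒ E} →
             (f ∘ g) ⊗₁ h ≈ (f ⊗₁ id) ∘ (g ⊗₁ h)
  split-l′ = ≈-trans (⊗-resp ≈-refl (≈-sym identityˡ)) ⊗-∘

  split-r′ : ∀ {A B C D E} {f : A ⇒ B} {g : D ⇒ E} {h : C ⇒ D} →
             f ⊗₁ (g ∘ h) ≈ (id ⊗₁ g) ∘ (f ⊗₁ h)
  split-r′ = ≈-trans (⊗-resp (≈-sym identityˡ) ≈-refl) ⊗-∘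

  ⊗-rl : ∀ {A B C D} {f : A ⇒ B} {g : C ⇒ D} → f ⊗₁ g ≈ (id ⊗₁ g) ∘ (f ⊗₁ id)
  ⊗-rl = ≈-trans (⊗-resp (≈-sym identityˡ) (≈-sym identityʳ)) ⊗-∘

  ⊗-lr : ∀ {A B C D} {f : A ⇒ B} {g : C ⇒ D} → f ⊗₁ g ≈ (f ⊗₁ id) ∘ (id ⊗₁ g)
  ⊗-lr = ≈-trans (⊗-resp (≈-sym identityʳ) (≈-sym identityˡ)) ⊗-∘


-- The Eilenberg–Moore category X^T of a symmetric comonoidal monad,
-- with its symmetric monoidal structure ⊗^n, unit (K, n_K)

module EM {o ℓ r} (X : SymMonCat o ℓ r) (𝕋 : SymComonoidalMonad X) where
  open SymMonCat X
  open SymComonoidalMonad 𝕋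
  open SMCProps X

  record IsAlg {A : Obj} (ν : T₀ A ⇒ A) : Set r where
    field
      alg-μ : ν ∘ μ ≈ ν ∘ T₁ ν
      alg-η : ν ∘ η ≈ id

  record Alg : Set (o ⊔ ℓ ⊔ r) where
    constructor alg
    field
      car   : Obj
      act   : T₀ car ⇒ car
      isAlg : IsAlg act
  open Alg public

  IsAlgHom : (𝔄 𝔅 : Alg) → car 𝔄 ⇒ car 𝔅 → Set r
  IsAlgHom 𝔄 𝔅 f = f ∘ act 𝔄 ≈ act 𝔅 ∘ T₁ f

  record AlgHom (𝔄 𝔅 : Alg) : Set (ℓ ⊔ r) where
    constructor algHom
    field
      hom  : car 𝔄 ⇒ car 𝔅
      comm : IsAlgHom 𝔄 𝔅 hom
  open AlgHom public

  private
    id-hom : ∀ {𝔄} → IsAlgHom 𝔄 𝔄 id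
    id-hom {𝔄} = begin
      id ∘ act 𝔄        ≈⟨ identityˡ ⟩
      act 𝔄             ≈⟨ ≈-sym identityʳ ⟩
      act 𝔄 ∘ id        ≈⟨ refl⟩∘⟨ ≈-sym identity ⟩
      act 𝔄 ∘ T₁ id     ∎
      where open HomReasoning

    ∘-hom : ∀ {𝔄 𝔅 ℭ} (g : AlgHom 𝔅 ℭ) (f : AlgHom 𝔄 𝔅) →
            IsAlgHom 𝔄 ℭ (hom g ∘ hom f)
    ∘-hom {𝔄} {𝔅} {ℭ} g f = begin
      (hom g ∘ hom f) ∘ act 𝔄       ≈⟨ assoc ⟩
      hom g ∘ (hom f ∘ act 𝔄)       ≈⟨ refl⟩∘⟨ comm f ⟩
      hom g ∘ (act 𝔅 ∘ T₁ (hom f))  ≈⟨ sym-assoc ⟩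
      (hom g ∘ act 𝔅) ∘ T₁ (hom f)  ≈⟨ comm g ⟩∘⟨refl ⟩
      (act ℭ ∘ T₁ (hom g)) ∘ T₁ (hom f) ≈⟨ assoc ⟩
      act ℭ ∘ (T₁ (hom g) ∘ T₁ (hom f)) ≈⟨ refl⟩∘⟨ ≈-sym homomorphism ⟩
      act ℭ ∘ T₁ (hom g ∘ hom f)    ∎
      where open HomReasoning

  EMcat : Category (o ⊔ ℓ ⊔ r) (ℓ ⊔ r) r
  EMcat = record
    { Obj = Alg
    ; _⇒_ = AlgHom
    ; _≈_ = λ f g → hom f ≈ hom g
    ; id = λ {𝔄} → algHom id (id-hom {𝔄})
    ; _∘_ = λ g f → algHom (hom g ∘ hom f) (∘-hom g f)
    ; equiv = record { refl = ≈-refl ; sym = ≈-sym ; trans = ≈-trans }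
    ; ∘-resp-≈ = ∘-resp-≈
    ; identityˡ = identityˡ
    ; identityʳ = identityʳ
    ; assoc = assoc
    }

  inv-hom : ∀ {𝔄 𝔅} (F : AlgHom 𝔄 𝔅) {g : car 𝔅 ⇒ car 𝔄} →
            g ∘ hom F ≈ id → hom F ∘ g ≈ id → IsAlgHom 𝔅 𝔄 g
  inv-hom {𝔄} {𝔅} (algHom f fh) {g} gf fg = begin
    g ∘ act 𝔅                      ≈⟨ refl⟩∘⟨ ≈-sym identityʳ ⟩
    g ∘ (act 𝔅 ∘ id)               ≈⟨ refl⟩∘⟨ refl⟩∘⟨ ≈-sym identity ⟩
    g ∘ (act 𝔅 ∘ T₁ id)            ≈⟨ refl⟩∘⟨ refl⟩∘⟨ F-resp-≈ (≈-sym fg) ⟩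
    g ∘ (act 𝔅 ∘ T₁ (f ∘ g))       ≈⟨ refl⟩∘⟨ refl⟩∘⟨ homomorphism ⟩
    g ∘ (act 𝔅 ∘ (T₁ f ∘ T₁ g))    ≈⟨ refl⟩∘⟨ sym-assoc ⟩
    g ∘ ((act 𝔅 ∘ T₁ f) ∘ T₁ g)    ≈⟨ refl⟩∘⟨ ≈-sym fh ⟩∘⟨refl ⟩
    g ∘ ((f ∘ act 𝔄) ∘ T₁ g)       ≈⟨ refl⟩∘⟨ assoc ⟩
    g ∘ (f ∘ (act 𝔄 ∘ T₁ g))       ≈⟨ sym-assoc ⟩
    (g ∘ f) ∘ (act 𝔄 ∘ T₁ g)       ≈⟨ gf ⟩∘⟨refl ⟩
    id ∘ (act 𝔄 ∘ T₁ g)            ≈⟨ identityˡ ⟩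
    act 𝔄 ∘ T₁ g                   ∎
    where open HomReasoning

  ⊗-act : ∀ {A B} → T₀ A ⇒ A → T₀ B ⇒ B → T₀ (A ⊗₀ B) ⇒ A ⊗₀ B
  ⊗-act ν ν′ = (ν ⊗₁ ν′) ∘ n

  ⊗-isAlg : ∀ (𝔄 𝔅 : Alg) → IsAlg (⊗-act (act 𝔄) (act 𝔅))
  ⊗-isAlg (alg A ν p) (alg B ν′ p′) = record { alg-μ = am ; alg-η = ae }
    where
    open HomReasoning
    open IsAlg p
    open IsAlg p′ renaming (alg-μ to alg-μ′; alg-η to alg-η′)
    am = begin
      ((ν ⊗₁ ν′) ∘ n) ∘ μ                       ≈⟨ assoc ⟩
      (ν ⊗₁ ν′) ∘ (n ∘ μ)                       ≈⟨ refl⟩∘⟨ μ-n ⟩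
      (ν ⊗₁ ν′) ∘ ((μ ⊗₁ μ) ∘ (n ∘ T₁ n))       ≈⟨ sym-assoc ⟩
      ((ν ⊗₁ ν′) ∘ (μ ⊗₁ μ)) ∘ (n ∘ T₁ n)       ≈⟨ ≈-sym ⊗-∘ ⟩∘⟨refl ⟩
      ((ν ∘ μ) ⊗₁ (ν′ ∘ μ)) ∘ (n ∘ T₁ n)        ≈⟨ ⊗-resp alg-μ alg-μ′ ⟩∘⟨refl ⟩
      ((ν ∘ T₁ ν) ⊗₁ (ν′ ∘ T₁ ν′)) ∘ (n ∘ T₁ n) ≈⟨ ⊗-∘ ⟩∘⟨refl ⟩
      ((ν ⊗₁ ν′) ∘ (T₁ ν ⊗₁ T₁ ν′)) ∘ (n ∘ T₁ n) ≈⟨ assoc ⟩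
      (ν ⊗₁ ν′) ∘ ((T₁ ν ⊗₁ T₁ ν′) ∘ (n ∘ T₁ n)) ≈⟨ refl⟩∘⟨ sym-assoc ⟩
      (ν ⊗₁ ν′) ∘ (((T₁ ν ⊗₁ T₁ ν′) ∘ n) ∘ T₁ n) ≈⟨ refl⟩∘⟨ ≈-sym n-nat ⟩∘⟨refl ⟩
      (ν ⊗₁ ν′) ∘ ((n ∘ T₁ (ν ⊗₁ ν′)) ∘ T₁ n)   ≈⟨ refl⟩∘⟨ assoc ⟩
      (ν ⊗₁ ν′) ∘ (n ∘ (T₁ (ν ⊗₁ ν′) ∘ T₁ n))   ≈⟨ refl⟩∘⟨ refl⟩∘⟨ ≈-sym homomorphism ⟩
      (ν ⊗₁ ν′) ∘ (n ∘ T₁ ((ν ⊗₁ ν′) ∘ n))      ≈⟨ sym-assoc ⟩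
      ((ν ⊗₁ ν′) ∘ n) ∘ T₁ ((ν ⊗₁ ν′) ∘ n)      ∎
    ae = begin
      ((ν ⊗₁ ν′) ∘ n) ∘ η       ≈⟨ assoc ⟩
      (ν ⊗₁ ν′) ∘ (n ∘ η)       ≈⟨ refl⟩∘⟨ η-n ⟩
      (ν ⊗₁ ν′) ∘ (η ⊗₁ η)      ≈⟨ ≈-sym ⊗-∘ ⟩
      (ν ∘ η) ⊗₁ (ν′ ∘ η)       ≈⟨ ⊗-resp alg-η alg-η′ ⟩
      id ⊗₁ id                  ≈⟨ ⊗-id ⟩
      id                        ∎

  infixr 10 _⊗ᵀ_
  _⊗ᵀ_ : Alg → Alg → Alg
  𝔄 ⊗ᵀ 𝔅 = alg (car 𝔄 ⊗₀ car 𝔅) (⊗-act (act 𝔄) (act 𝔅)) (⊗-isAlg 𝔄 𝔅)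

  Kᵀ : Alg
  Kᵀ = alg K nK (record { alg-μ = μ-nK ; alg-η = η-nK })

  private
    ⊗-hom : ∀ {𝔄 𝔅 ℭ 𝔇} (f : AlgHom 𝔄 𝔅) (g : AlgHom ℭ 𝔇) →
            IsAlgHom (𝔄 ⊗ᵀ ℭ) (𝔅 ⊗ᵀ 𝔇) (hom f ⊗₁ hom g)
    ⊗-hom {𝔄} {𝔅} {ℭ} {𝔇} (algHom f fc) (algHom g gc) = begin
      (f ⊗₁ g) ∘ ((act 𝔄 ⊗₁ act ℭ) ∘ n)                 ≈⟨ sym-assoc ⟩
      ((f ⊗₁ g) ∘ (act 𝔄 ⊗₁ act ℭ)) ∘ n                 ≈⟨ ≈-sym ⊗-∘ ⟩∘⟨refl ⟩
      ((f ∘ act 𝔄) ⊗₁ (g ∘ act ℭ)) ∘ n                  ≈⟨ ⊗-resp fc gc ⟩∘⟨refl ⟩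
      ((act 𝔅 ∘ T₁ f) ⊗₁ (act 𝔇 ∘ T₁ g)) ∘ n            ≈⟨ ⊗-∘ ⟩∘⟨refl ⟩
      ((act 𝔅 ⊗₁ act 𝔇) ∘ (T₁ f ⊗₁ T₁ g)) ∘ n           ≈⟨ assoc ⟩
      (act 𝔅 ⊗₁ act 𝔇) ∘ ((T₁ f ⊗₁ T₁ g) ∘ n)           ≈⟨ refl⟩∘⟨ ≈-sym n-nat ⟩
      (act 𝔅 ⊗₁ act 𝔇) ∘ (n ∘ T₁ (f ⊗₁ g))              ≈⟨ sym-assoc ⟩
      ((act 𝔅 ⊗₁ act 𝔇) ∘ n) ∘ T₁ (f ⊗₁ g)              ∎
      where open HomReasoning

    α-hom : ∀ {𝔄 𝔅 ℭ} → IsAlgHom ((𝔄 ⊗ᵀ 𝔅) ⊗ᵀ ℭ) (𝔄 ⊗ᵀ (𝔅 ⊗ᵀ ℭ)) α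
    α-hom {alg A a _} {alg B b _} {alg C c _} = begin
      α ∘ ((((a ⊗₁ b) ∘ n) ⊗₁ c) ∘ n)              ≈⟨ refl⟩∘⟨ split-l ⟩∘⟨refl ⟩
      α ∘ ((((a ⊗₁ b) ⊗₁ c) ∘ (n ⊗₁ id)) ∘ n)      ≈⟨ refl⟩∘⟨ assoc ⟩
      α ∘ (((a ⊗₁ b) ⊗₁ c) ∘ ((n ⊗₁ id) ∘ n))      ≈⟨ sym-assoc ⟩
      (α ∘ ((a ⊗₁ b) ⊗₁ c)) ∘ ((n ⊗₁ id) ∘ n)      ≈⟨ α-nat ⟩∘⟨refl ⟩
      ((a ⊗₁ (b ⊗₁ c)) ∘ α) ∘ ((n ⊗₁ id) ∘ n)      ≈⟨ assoc ⟩
      (a ⊗₁ (b ⊗₁ c)) ∘ (α ∘ ((n ⊗₁ id) ∘ n))      ≈⟨ refl⟩∘⟨ n-α ⟩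
      (a ⊗₁ (b ⊗₁ c)) ∘ ((id ⊗₁ n) ∘ (n ∘ T₁ α))   ≈⟨ sym-assoc ⟩
      ((a ⊗₁ (b ⊗₁ c)) ∘ (id ⊗₁ n)) ∘ (n ∘ T₁ α)   ≈⟨ ≈-sym split-r ⟩∘⟨refl ⟩
      (a ⊗₁ ((b ⊗₁ c) ∘ n)) ∘ (n ∘ T₁ α)           ≈⟨ sym-assoc ⟩
      ((a ⊗₁ ((b ⊗₁ c) ∘ n)) ∘ n) ∘ T₁ α           ∎
      where open HomReasoning

    lu-hom : ∀ {𝔄} → IsAlgHom (Kᵀ ⊗ᵀ 𝔄) 𝔄 lu
    lu-hom {alg A a _} = begin
      lu ∘ ((nK ⊗₁ a) ∘ n)                 ≈⟨ refl⟩∘⟨ ⊗-rl ⟩∘⟨refl ⟩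
      lu ∘ (((id ⊗₁ a) ∘ (nK ⊗₁ id)) ∘ n)  ≈⟨ refl⟩∘⟨ assoc ⟩
      lu ∘ ((id ⊗₁ a) ∘ ((nK ⊗₁ id) ∘ n))  ≈⟨ sym-assoc ⟩
      (lu ∘ (id ⊗₁ a)) ∘ ((nK ⊗₁ id) ∘ n)  ≈⟨ lu-nat ⟩∘⟨refl ⟩
      (a ∘ lu) ∘ ((nK ⊗₁ id) ∘ n)          ≈⟨ assoc ⟩
      a ∘ (lu ∘ ((nK ⊗₁ id) ∘ n))          ≈⟨ refl⟩∘⟨ n-lu ⟩
      a ∘ T₁ lu                            ∎
      where open HomReasoning

    ru-hom : ∀ {𝔄} → IsAlgHom (𝔄 ⊗ᵀ Kᵀ) 𝔄 ru
    ru-hom {alg A a _} = begin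
      ru ∘ ((a ⊗₁ nK) ∘ n)                 ≈⟨ refl⟩∘⟨ ⊗-lr ⟩∘⟨refl ⟩
      ru ∘ (((a ⊗₁ id) ∘ (id ⊗₁ nK)) ∘ n)  ≈⟨ refl⟩∘⟨ assoc ⟩
      ru ∘ ((a ⊗₁ id) ∘ ((id ⊗₁ nK) ∘ n))  ≈⟨ sym-assoc ⟩
      (ru ∘ (a ⊗₁ id)) ∘ ((id ⊗₁ nK) ∘ n)  ≈⟨ ru-nat ⟩∘⟨refl ⟩
      (a ∘ ru) ∘ ((id ⊗₁ nK) ∘ n)          ≈⟨ assoc ⟩
      a ∘ (ru ∘ ((id ⊗₁ nK) ∘ n))          ≈⟨ refl⟩∘⟨ n-ru ⟩
      a ∘ T₁ ru                            ∎
      where open HomReasoning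

    σ-hom : ∀ {𝔄 𝔅} → IsAlgHom (𝔄 ⊗ᵀ 𝔅) (𝔅 ⊗ᵀ 𝔄) σ
    σ-hom {alg A a _} {alg B b _} = begin
      σ ∘ ((a ⊗₁ b) ∘ n)      ≈⟨ sym-assoc ⟩
      (σ ∘ (a ⊗₁ b)) ∘ n      ≈⟨ σ-nat ⟩∘⟨refl ⟩
      ((b ⊗₁ a) ∘ σ) ∘ n      ≈⟨ assoc ⟩
      (b ⊗₁ a) ∘ (σ ∘ n)      ≈⟨ refl⟩∘⟨ n-σ ⟩
      (b ⊗₁ a) ∘ (n ∘ T₁ σ)   ≈⟨ sym-assoc ⟩
      ((b ⊗₁ a) ∘ n) ∘ T₁ σ   ∎
      where open HomReasoning

  EMmon : SymMonoidal EMcat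
  EMmon = record
    { _⊗₀_ = _⊗ᵀ_
    ; _⊗₁_ = λ f g → algHom (hom f ⊗₁ hom g) (⊗-hom f g)
    ; ⊗-id = ⊗-id
    ; ⊗-∘ = ⊗-∘
    ; ⊗-resp = ⊗-resp
    ; K = Kᵀ
    ; α = λ {𝔄 𝔅 ℭ} → algHom α (α-hom {𝔄} {𝔅} {ℭ})
    ; α⁻¹ = λ {𝔄 𝔅 ℭ} → algHom α⁻¹
              (inv-hom {(𝔄 ⊗ᵀ 𝔅) ⊗ᵀ ℭ} {𝔄 ⊗ᵀ (𝔅 ⊗ᵀ ℭ)} (algHom α (α-hom {𝔄} {𝔅} {ℭ})) {α⁻¹} α-isoˡ α-isoʳ)
    ; α-isoˡ = λ {𝔄 𝔅 ℭ} → α-isoˡ {car 𝔄} {car 𝔅} {car ℭ}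
    ; α-isoʳ = λ {𝔄 𝔅 ℭ} → α-isoʳ {car 𝔄} {car 𝔅} {car ℭ}
    ; α-nat = α-nat
    ; lu = λ {𝔄} → algHom lu (lu-hom {𝔄})
    ; lu⁻¹ = λ {𝔄} → algHom lu⁻¹ (inv-hom {Kᵀ ⊗ᵀ 𝔄} {𝔄} (algHom lu (lu-hom {𝔄})) {lu⁻¹} lu-isoˡ lu-isoʳ)
    ; lu-isoˡ = λ {𝔄} → lu-isoˡ {car 𝔄}
    ; lu-isoʳ = λ {𝔄} → lu-isoʳ {car 𝔄}
    ; lu-nat = lu-nat
    ; ru = λ {𝔄} → algHom ru (ru-hom {𝔄})
    ; ru⁻¹ = λ {𝔄} → algHom ru⁻¹ (inv-hom {𝔄 ⊗ᵀ Kᵀ} {𝔄} (algHom ru (ru-hom {𝔄})) {ru⁻¹} ru-isoˡ ru-isoʳ)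
    ; ru-isoˡ = λ {𝔄} → ru-isoˡ {car 𝔄}
    ; ru-isoʳ = λ {𝔄} → ru-isoʳ {car 𝔄}
    ; ru-nat = ru-nat
    ; σ = λ {𝔄 𝔅} → algHom σ (σ-hom {𝔄} {𝔅})
    ; σ-nat = σ-nat
    ; σ-inv = λ {𝔄 𝔅} → σ-inv {car 𝔄} {car 𝔅}
    ; pentagon = pentagon
    ; triangle = triangle
    ; hexagon = hexagon
    }

  Xᵀ : SymMonCat (o ⊔ ℓ ⊔ r) (ℓ ⊔ r) r
  Xᵀ = record { cat = EMcat ; mon = EMmon }

-- The category X^! of coalgebras of the (monoidal) comonad underlying a
-- monoidal coalgebra modality, with its symmetric monoidal structure
-- ⊗^m, unit (K, m_K)

module CoEM {o ℓ r} (X : SymMonCat o ℓ r) (𝔹 : MonoidalCoalgebraModality X) where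
  open SymMonCat X
  open MonoidalCoalgebraModality 𝔹
  open SMCProps X

  record IsCoalg {A : Obj} (ω : A ⇒ !₀ A) : Set r where
    field
      coalg-ε : ε ∘ ω ≈ id
      coalg-δ : δ ∘ ω ≈ !₁ ω ∘ ω

  record Coalg : Set (o ⊔ ℓ ⊔ r) where
    constructor coalg
    field
      car     : Obj
      coact   : car ⇒ !₀ car
      isCoalg : IsCoalg coact
  open Coalg public

  IsCoalgHom : (ℭ 𝔇 : Coalg) → car ℭ ⇒ car 𝔇 → Set r
  IsCoalgHom ℭ 𝔇 f = coact 𝔇 ∘ f ≈ !₁ f ∘ coact ℭ

  record CoalgHom (ℭ 𝔇 : Coalg) : Set (ℓ ⊔ r) where
    constructor coalgHom
    field
      hom  : car ℭ ⇒ car 𝔇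
      comm : IsCoalgHom ℭ 𝔇 hom
  open CoalgHom public

  private
    id-hom : ∀ {ℭ} → IsCoalgHom ℭ ℭ id
    id-hom {ℭ} = begin
      coact ℭ ∘ id      ≈⟨ identityʳ ⟩
      coact ℭ           ≈⟨ ≈-sym identityˡ ⟩
      id ∘ coact ℭ      ≈⟨ ≈-sym identity ⟩∘⟨refl ⟩
      !₁ id ∘ coact ℭ   ∎
      where open HomReasoning

    ∘-hom : ∀ {𝔄 𝔅 ℭ} (g : CoalgHom 𝔅 ℭ) (f : CoalgHom 𝔄 𝔅) →
            IsCoalgHom 𝔄 ℭ (hom g ∘ hom f)
    ∘-hom {𝔄} {𝔅} {ℭ} g f = begin
      coact ℭ ∘ (hom g ∘ hom f)            ≈⟨ sym-assoc ⟩
      (coact ℭ ∘ hom g) ∘ hom f            ≈⟨ comm g ⟩∘⟨refl ⟩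
      (!₁ (hom g) ∘ coact 𝔅) ∘ hom f       ≈⟨ assoc ⟩
      !₁ (hom g) ∘ (coact 𝔅 ∘ hom f)       ≈⟨ refl⟩∘⟨ comm f ⟩
      !₁ (hom g) ∘ (!₁ (hom f) ∘ coact 𝔄)  ≈⟨ sym-assoc ⟩
      (!₁ (hom g) ∘ !₁ (hom f)) ∘ coact 𝔄  ≈⟨ ≈-sym homomorphism ⟩∘⟨refl ⟩
      !₁ (hom g ∘ hom f) ∘ coact 𝔄         ∎
      where open HomReasoning

  CoEMcat : Category (o ⊔ ℓ ⊔ r) (ℓ ⊔ r) r
  CoEMcat = record
    { Obj = Coalg
    ; _⇒_ = CoalgHom
    ; _≈_ = λ f g → hom f ≈ hom g
    ; id = λ {ℭ} → coalgHom id (id-hom {ℭ})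
    ; _∘_ = λ g f → coalgHom (hom g ∘ hom f) (∘-hom g f)
    ; equiv = record { refl = ≈-refl ; sym = ≈-sym ; trans = ≈-trans }
    ; ∘-resp-≈ = ∘-resp-≈
    ; identityˡ = identityˡ
    ; identityʳ = identityʳ
    ; assoc = assoc
    }

  inv-hom : ∀ {ℭ 𝔇} (F : CoalgHom ℭ 𝔇) {g : car 𝔇 ⇒ car ℭ} →
            g ∘ hom F ≈ id → hom F ∘ g ≈ id → IsCoalgHom 𝔇 ℭ g
  inv-hom {ℭ} {𝔇} (coalgHom f fh) {g} gf fg = begin
    coact ℭ ∘ g                        ≈⟨ ≈-sym identityˡ ⟩
    id ∘ (coact ℭ ∘ g)                 ≈⟨ ≈-sym identity ⟩∘⟨refl ⟩
    !₁ id ∘ (coact ℭ ∘ g)              ≈⟨ F-resp-≈ (≈-sym gf) ⟩∘⟨refl ⟩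
    !₁ (g ∘ f) ∘ (coact ℭ ∘ g)         ≈⟨ homomorphism ⟩∘⟨refl ⟩
    (!₁ g ∘ !₁ f) ∘ (coact ℭ ∘ g)      ≈⟨ assoc ⟩
    !₁ g ∘ (!₁ f ∘ (coact ℭ ∘ g))      ≈⟨ refl⟩∘⟨ sym-assoc ⟩
    !₁ g ∘ ((!₁ f ∘ coact ℭ) ∘ g)      ≈⟨ refl⟩∘⟨ ≈-sym fh ⟩∘⟨refl ⟩
    !₁ g ∘ ((coact 𝔇 ∘ f) ∘ g)         ≈⟨ refl⟩∘⟨ assoc ⟩
    !₁ g ∘ (coact 𝔇 ∘ (f ∘ g))         ≈⟨ refl⟩∘⟨ refl⟩∘⟨ fg ⟩
    !₁ g ∘ (coact 𝔇 ∘ id)              ≈⟨ refl⟩∘⟨ identityʳ ⟩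
    !₁ g ∘ coact 𝔇                     ∎
    where open HomReasoning

  ⊗-coact : ∀ {A B} → A ⇒ !₀ A → B ⇒ !₀ B → A ⊗₀ B ⇒ !₀ (A ⊗₀ B)
  ⊗-coact ω ω′ = m ∘ (ω ⊗₁ ω′)

  ⊗-isCoalg : ∀ (ℭ 𝔇 : Coalg) → IsCoalg (⊗-coact (coact ℭ) (coact 𝔇))
  ⊗-isCoalg (coalg A ω p) (coalg B ω′ p′) = record { coalg-ε = ce ; coalg-δ = cd }
    where
    open HomReasoning
    open IsCoalg p
    open IsCoalg p′ renaming (coalg-ε to coalg-ε′; coalg-δ to coalg-δ′)
    ce = begin
      ε ∘ (m ∘ (ω ⊗₁ ω′))     ≈⟨ sym-assoc ⟩
      (ε ∘ m) ∘ (ω ⊗₁ ω′)     ≈⟨ ε-m ⟩∘⟨refl ⟩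
      (ε ⊗₁ ε) ∘ (ω ⊗₁ ω′)    ≈⟨ ≈-sym ⊗-∘ ⟩
      (ε ∘ ω) ⊗₁ (ε ∘ ω′)     ≈⟨ ⊗-resp coalg-ε coalg-ε′ ⟩
      id ⊗₁ id                ≈⟨ ⊗-id ⟩
      id                      ∎
    cd = begin
      δ ∘ (m ∘ (ω ⊗₁ ω′))                         ≈⟨ sym-assoc ⟩
      (δ ∘ m) ∘ (ω ⊗₁ ω′)                         ≈⟨ δ-m ⟩∘⟨refl ⟩
      (!₁ m ∘ (m ∘ (δ ⊗₁ δ))) ∘ (ω ⊗₁ ω′)         ≈⟨ assoc ⟩
      !₁ m ∘ ((m ∘ (δ ⊗₁ δ)) ∘ (ω ⊗₁ ω′))         ≈⟨ refl⟩∘⟨ assoc ⟩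
      !₁ m ∘ (m ∘ ((δ ⊗₁ δ) ∘ (ω ⊗₁ ω′)))         ≈⟨ refl⟩∘⟨ refl⟩∘⟨ ≈-sym ⊗-∘ ⟩
      !₁ m ∘ (m ∘ ((δ ∘ ω) ⊗₁ (δ ∘ ω′)))          ≈⟨ refl⟩∘⟨ refl⟩∘⟨ ⊗-resp coalg-δ coalg-δ′ ⟩
      !₁ m ∘ (m ∘ ((!₁ ω ∘ ω) ⊗₁ (!₁ ω′ ∘ ω′)))   ≈⟨ refl⟩∘⟨ refl⟩∘⟨ ⊗-∘ ⟩
      !₁ m ∘ (m ∘ ((!₁ ω ⊗₁ !₁ ω′) ∘ (ω ⊗₁ ω′)))  ≈⟨ refl⟩∘⟨ sym-assoc ⟩
      !₁ m ∘ ((m ∘ (!₁ ω ⊗₁ !₁ ω′)) ∘ (ω ⊗₁ ω′))  ≈⟨ refl⟩∘⟨ m-nat ⟩∘⟨refl ⟩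
      !₁ m ∘ ((!₁ (ω ⊗₁ ω′) ∘ m) ∘ (ω ⊗₁ ω′))     ≈⟨ refl⟩∘⟨ assoc ⟩
      !₁ m ∘ (!₁ (ω ⊗₁ ω′) ∘ (m ∘ (ω ⊗₁ ω′)))     ≈⟨ sym-assoc ⟩
      (!₁ m ∘ !₁ (ω ⊗₁ ω′)) ∘ (m ∘ (ω ⊗₁ ω′))     ≈⟨ ≈-sym homomorphism ⟩∘⟨refl ⟩
      !₁ (m ∘ (ω ⊗₁ ω′)) ∘ (m ∘ (ω ⊗₁ ω′))        ∎

  infixr 10 _⊗ᶜ_
  _⊗ᶜ_ : Coalg → Coalg → Coalg
  ℭ ⊗ᶜ 𝔇 = coalg (car ℭ ⊗₀ car 𝔇) (⊗-coact (coact ℭ) (coact 𝔇)) (⊗-isCoalg ℭ 𝔇)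

  Kᶜ : Coalg
  Kᶜ = coalg K mK (record { coalg-ε = ε-mK ; coalg-δ = δ-mK })

  private
    ⊗-hom : ∀ {𝔄 𝔅 ℭ 𝔇} (f : CoalgHom 𝔄 𝔅) (g : CoalgHom ℭ 𝔇) →
            IsCoalgHom (𝔄 ⊗ᶜ ℭ) (𝔅 ⊗ᶜ 𝔇) (hom f ⊗₁ hom g)
    ⊗-hom {𝔄} {𝔅} {ℭ} {𝔇} (coalgHom f fc) (coalgHom g gc) = begin
      (m ∘ (coact 𝔅 ⊗₁ coact 𝔇)) ∘ (f ⊗₁ g)           ≈⟨ assoc ⟩
      m ∘ ((coact 𝔅 ⊗₁ coact 𝔇) ∘ (f ⊗₁ g))           ≈⟨ refl⟩∘⟨ ≈-sym ⊗-∘ ⟩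
      m ∘ ((coact 𝔅 ∘ f) ⊗₁ (coact 𝔇 ∘ g))            ≈⟨ refl⟩∘⟨ ⊗-resp fc gc ⟩
      m ∘ ((!₁ f ∘ coact 𝔄) ⊗₁ (!₁ g ∘ coact ℭ))      ≈⟨ refl⟩∘⟨ ⊗-∘ ⟩
      m ∘ ((!₁ f ⊗₁ !₁ g) ∘ (coact 𝔄 ⊗₁ coact ℭ))     ≈⟨ sym-assoc ⟩
      (m ∘ (!₁ f ⊗₁ !₁ g)) ∘ (coact 𝔄 ⊗₁ coact ℭ)     ≈⟨ m-nat ⟩∘⟨refl ⟩
      (!₁ (f ⊗₁ g) ∘ m) ∘ (coact 𝔄 ⊗₁ coact ℭ)        ≈⟨ assoc ⟩
      !₁ (f ⊗₁ g) ∘ (m ∘ (coact 𝔄 ⊗₁ coact ℭ))        ∎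
      where open HomReasoning

    α-hom : ∀ {𝔄 𝔅 ℭ} → IsCoalgHom ((𝔄 ⊗ᶜ 𝔅) ⊗ᶜ ℭ) (𝔄 ⊗ᶜ (𝔅 ⊗ᶜ ℭ)) α
    α-hom {coalg A a _} {coalg B b _} {coalg C c _} = begin
      (m ∘ (a ⊗₁ (m ∘ (b ⊗₁ c)))) ∘ α               ≈⟨ (refl⟩∘⟨ split-r′) ⟩∘⟨refl ⟩
      (m ∘ ((id ⊗₁ m) ∘ (a ⊗₁ (b ⊗₁ c)))) ∘ α       ≈⟨ assoc ⟩
      m ∘ (((id ⊗₁ m) ∘ (a ⊗₁ (b ⊗₁ c))) ∘ α)       ≈⟨ refl⟩∘⟨ assoc ⟩
      m ∘ ((id ⊗₁ m) ∘ ((a ⊗₁ (b ⊗₁ c)) ∘ α))       ≈⟨ refl⟩∘⟨ refl⟩∘⟨ ≈-sym α-nat ⟩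
      m ∘ ((id ⊗₁ m) ∘ (α ∘ ((a ⊗₁ b) ⊗₁ c)))       ≈⟨ refl⟩∘⟨ sym-assoc ⟩
      m ∘ (((id ⊗₁ m) ∘ α) ∘ ((a ⊗₁ b) ⊗₁ c))       ≈⟨ sym-assoc ⟩
      (m ∘ ((id ⊗₁ m) ∘ α)) ∘ ((a ⊗₁ b) ⊗₁ c)       ≈⟨ m-α ⟩∘⟨refl ⟩
      (!₁ α ∘ (m ∘ (m ⊗₁ id))) ∘ ((a ⊗₁ b) ⊗₁ c)    ≈⟨ assoc ⟩
      !₁ α ∘ ((m ∘ (m ⊗₁ id)) ∘ ((a ⊗₁ b) ⊗₁ c))    ≈⟨ refl⟩∘⟨ assoc ⟩
      !₁ α ∘ (m ∘ ((m ⊗₁ id) ∘ ((a ⊗₁ b) ⊗₁ c)))    ≈⟨ refl⟩∘⟨ refl⟩∘⟨ ≈-sym split-l′ ⟩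
      !₁ α ∘ (m ∘ ((m ∘ (a ⊗₁ b)) ⊗₁ c))            ∎
      where open HomReasoning

    lu-hom : ∀ {𝔄} → IsCoalgHom (Kᶜ ⊗ᶜ 𝔄) 𝔄 lu
    lu-hom {coalg A a _} = begin
      a ∘ lu                                   ≈⟨ ≈-sym lu-nat ⟩
      lu ∘ (id ⊗₁ a)                           ≈⟨ ≈-sym m-lu ⟩∘⟨refl ⟩
      (!₁ lu ∘ (m ∘ (mK ⊗₁ id))) ∘ (id ⊗₁ a)   ≈⟨ assoc ⟩
      !₁ lu ∘ ((m ∘ (mK ⊗₁ id)) ∘ (id ⊗₁ a))   ≈⟨ refl⟩∘⟨ assoc ⟩
      !₁ lu ∘ (m ∘ ((mK ⊗₁ id) ∘ (id ⊗₁ a)))   ≈⟨ refl⟩∘⟨ refl⟩∘⟨ ≈-sym ⊗-lr ⟩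
      !₁ lu ∘ (m ∘ (mK ⊗₁ a))                  ∎
      where open HomReasoning

    ru-hom : ∀ {𝔄} → IsCoalgHom (𝔄 ⊗ᶜ Kᶜ) 𝔄 ru
    ru-hom {coalg A a _} = begin
      a ∘ ru                                   ≈⟨ ≈-sym ru-nat ⟩
      ru ∘ (a ⊗₁ id)                           ≈⟨ ≈-sym m-ru ⟩∘⟨refl ⟩
      (!₁ ru ∘ (m ∘ (id ⊗₁ mK))) ∘ (a ⊗₁ id)   ≈⟨ assoc ⟩
      !₁ ru ∘ ((m ∘ (id ⊗₁ mK)) ∘ (a ⊗₁ id))   ≈⟨ refl⟩∘⟨ assoc ⟩
      !₁ ru ∘ (m ∘ ((id ⊗₁ mK) ∘ (a ⊗₁ id)))   ≈⟨ refl⟩∘⟨ refl⟩∘⟨ ≈-sym ⊗-rl ⟩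
      !₁ ru ∘ (m ∘ (a ⊗₁ mK))                  ∎
      where open HomReasoning

    σ-hom : ∀ {𝔄 𝔅} → IsCoalgHom (𝔄 ⊗ᶜ 𝔅) (𝔅 ⊗ᶜ 𝔄) σ
    σ-hom {coalg A a _} {coalg B b _} = begin
      (m ∘ (b ⊗₁ a)) ∘ σ      ≈⟨ assoc ⟩
      m ∘ ((b ⊗₁ a) ∘ σ)      ≈⟨ refl⟩∘⟨ ≈-sym σ-nat ⟩
      m ∘ (σ ∘ (a ⊗₁ b))      ≈⟨ sym-assoc ⟩
      (m ∘ σ) ∘ (a ⊗₁ b)      ≈⟨ m-σ ⟩∘⟨refl ⟩
      (!₁ σ ∘ m) ∘ (a ⊗₁ b)   ≈⟨ assoc ⟩
      !₁ σ ∘ (m ∘ (a ⊗₁ b))   ∎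
      where open HomReasoning

  CoEMmon : SymMonoidal CoEMcat
  CoEMmon = record
    { _⊗₀_ = _⊗ᶜ_
    ; _⊗₁_ = λ f g → coalgHom (hom f ⊗₁ hom g) (⊗-hom f g)
    ; ⊗-id = ⊗-id
    ; ⊗-∘ = ⊗-∘
    ; ⊗-resp = ⊗-resp
    ; K = Kᶜ
    ; α = λ {𝔄 𝔅 ℭ} → coalgHom α (α-hom {𝔄} {𝔅} {ℭ})
    ; α⁻¹ = λ {𝔄 𝔅 ℭ} → coalgHom α⁻¹
              (inv-hom {(𝔄 ⊗ᶜ 𝔅) ⊗ᶜ ℭ} {𝔄 ⊗ᶜ (𝔅 ⊗ᶜ ℭ)} (coalgHom α (α-hom {𝔄} {𝔅} {ℭ})) {α⁻¹} α-isoˡ α-isoʳ)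
    ; α-isoˡ = λ {𝔄 𝔅 ℭ} → α-isoˡ {car 𝔄} {car 𝔅} {car ℭ}
    ; α-isoʳ = λ {𝔄 𝔅 ℭ} → α-isoʳ {car 𝔄} {car 𝔅} {car ℭ}
    ; α-nat = α-nat
    ; lu = λ {𝔄} → coalgHom lu (lu-hom {𝔄})
    ; lu⁻¹ = λ {𝔄} → coalgHom lu⁻¹ (inv-hom {Kᶜ ⊗ᶜ 𝔄} {𝔄} (coalgHom lu (lu-hom {𝔄})) {lu⁻¹} lu-isoˡ lu-isoʳ)
    ; lu-isoˡ = λ {𝔄} → lu-isoˡ {car 𝔄}
    ; lu-isoʳ = λ {𝔄} → lu-isoʳ {car 𝔄}
    ; lu-nat = lu-nat
    ; ru = λ {𝔄} → coalgHom ru (ru-hom {𝔄})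
    ; ru⁻¹ = λ {𝔄} → coalgHom ru⁻¹ (inv-hom {𝔄 ⊗ᶜ Kᶜ} {𝔄} (coalgHom ru (ru-hom {𝔄})) {ru⁻¹} ru-isoˡ ru-isoʳ)
    ; ru-isoˡ = λ {𝔄} → ru-isoˡ {car 𝔄}
    ; ru-isoʳ = λ {𝔄} → ru-isoʳ {car 𝔄}
    ; ru-nat = ru-nat
    ; σ = λ {𝔄 𝔅} → coalgHom σ (σ-hom {𝔄} {𝔅})
    ; σ-nat = σ-nat
    ; σ-inv = λ {𝔄 𝔅} → σ-inv {car 𝔄} {car 𝔅}
    ; pentagon = pentagon
    ; triangle = triangle
    ; hexagon = hexagon
    }

  X! : SymMonCat (o ⊔ ℓ ⊔ r) (ℓ ⊔ r) r
  X! = record { cat = CoEMcat ; mon = CoEMmon }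

-- The three classes of structures in Proposition 6.5

module Correspondence {o ℓ r} (X : SymMonCat o ℓ r)
       (𝕋 : SymComonoidalMonad X) (𝔹 : MonoidalCoalgebraModality X) where
  open SymMonCat X
  private
    module 𝕋 = SymComonoidalMonad 𝕋
    module 𝔹 = MonoidalCoalgebraModality 𝔹
    module A = EM X 𝕋
    module C = CoEM X 𝔹
  open 𝕋 using (T₀; T₁; μ; η; n; nK)
  open 𝔹 using (!₀; !₁; δ; ε; m; mK; Δ; e)

  -- (1) symmetric monoidal mixed distributive laws of T over !
  --     (the component λ_A : T!A → !TA is called  dist)

  record SymMonMixedDistLaw : Set (o ⊔ ℓ ⊔ r) where
    field
      dist     : ∀ {A} → T₀ (!₀ A) ⇒ !₀ (T₀ A)
      dist-nat : ∀ {A B} {f : A ⇒ B} → dist ∘ T₁ (!₁ f) ≈ !₁ (T₁ f) ∘ dist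
      dist-μ   : ∀ {A} → dist {A} ∘ μ ≈ !₁ μ ∘ dist ∘ T₁ dist
      dist-η   : ∀ {A} → dist {A} ∘ η ≈ !₁ η
      dist-δ   : ∀ {A} → δ ∘ dist {A} ≈ !₁ dist ∘ dist ∘ T₁ δ
      dist-ε   : ∀ {A} → ε ∘ dist {A} ≈ T₁ ε
      dist-m   : ∀ {A B} → !₁ n ∘ dist ∘ T₁ (m {A} {B}) ≈ m ∘ (dist ⊗₁ dist) ∘ n
      dist-mK  : !₁ nK ∘ dist ∘ T₁ mK ≈ mK ∘ nK

  DistLaw-setoid : Setoid (o ⊔ ℓ ⊔ r) (o ⊔ r)
  DistLaw-setoid = record
    { Carrier = SymMonMixedDistLaw
    ; _≈_ = λ L L′ → ∀ {A} → SymMonMixedDistLaw.dist L {A} ≈ SymMonMixedDistLaw.dist L′ {A}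
    ; isEquivalence = record
      { refl = ≈-refl ; sym = λ p → ≈-sym p ; trans = λ p q → ≈-trans p q } }

  -- (2) liftings of the monoidal coalgebra modality to (X^T, ⊗^n, (K, n_K)).
  -- A functor !̃ on X^T with U^T !̃ = ! U^T consists of a T-algebra
  -- structure on !A for every T-algebra (A, ν), such that !f is an algebra
  -- morphism for every algebra morphism f (then !̃ f is the algebra
  -- morphism with underlying map !f).  The components of the lifted
  -- structure are the algebra morphisms with underlying maps
  -- δ_A, ε_A, Δ_A, e_A, m_{A,B}, m_K.

  record LiftAct : Set (o ⊔ ℓ ⊔ r) where
    field
      act       : (𝔄 : A.Alg) → T₀ (!₀ (A.car 𝔄)) ⇒ !₀ (A.car 𝔄)
      act-isAlg : (𝔄 : A.Alg) → A.IsAlg (act 𝔄)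

  lift! : LiftAct → A.Alg → A.Alg
  lift! L 𝔄 = A.alg (!₀ (A.car 𝔄)) (LiftAct.act L 𝔄) (LiftAct.act-isAlg L 𝔄)

  record LiftHoms (L : LiftAct) : Set (o ⊔ ℓ ⊔ r) where
    private
      !̃ = lift! L
    field
      !-hom  : ∀ {𝔄 𝔅} (f : A.AlgHom 𝔄 𝔅) → A.IsAlgHom (!̃ 𝔄) (!̃ 𝔅) (!₁ (A.hom f))
      δ-hom  : ∀ 𝔄 → A.IsAlgHom (!̃ 𝔄) (!̃ (!̃ 𝔄)) δ
      ε-hom  : ∀ 𝔄 → A.IsAlgHom (!̃ 𝔄) 𝔄 ε
      Δ-hom  : ∀ 𝔄 → A.IsAlgHom (!̃ 𝔄) (!̃ 𝔄 A.⊗ᵀ !̃ 𝔄) Δ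
      e-hom  : ∀ 𝔄 → A.IsAlgHom (!̃ 𝔄) A.Kᵀ e
      m-hom  : ∀ 𝔄 𝔅 → A.IsAlgHom (!̃ 𝔄 A.⊗ᵀ !̃ 𝔅) (!̃ (𝔄 A.⊗ᵀ 𝔅)) m
      mK-hom : A.IsAlgHom A.Kᵀ (!̃ A.Kᵀ) mK

  liftedMCMData : (L : LiftAct) → LiftHoms L → MCMData A.Xᵀ
  liftedMCMData L H = record
    { Bang = record
      { F₀ = lift! L
      ; F₁ = λ f → A.algHom (!₁ (A.hom f)) (!-hom f)
      ; identity = 𝔹.identity
      ; homomorphism = 𝔹.homomorphism
      ; F-resp-≈ = 𝔹.F-resp-≈
      }
    ; δ  = λ {𝔄} → A.algHom δ (δ-hom 𝔄)
    ; ε  = λ {𝔄} → A.algHom ε (ε-hom 𝔄)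
    ; m  = λ {𝔄 𝔅} → A.algHom m (m-hom 𝔄 𝔅)
    ; mK = A.algHom mK mK-hom
    ; Δ  = λ {𝔄} → A.algHom Δ (Δ-hom 𝔄)
    ; e  = λ {𝔄} → A.algHom e (e-hom 𝔄)
    }
    where open LiftHoms H

  record LiftedMCM : Set (o ⊔ ℓ ⊔ r) where
    field
      acts  : LiftAct
      homs  : LiftHoms acts
      isMCM : IsMCM A.Xᵀ (liftedMCMData acts homs)
    open LiftAct acts public

  LiftedMCM-setoid : Setoid (o ⊔ ℓ ⊔ r) (o ⊔ ℓ ⊔ r)
  LiftedMCM-setoid = record
    { Carrier = LiftedMCM
    ; _≈_ = λ L L′ → ∀ 𝔄 → LiftedMCM.act L 𝔄 ≈ LiftedMCM.act L′ 𝔄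
    ; isEquivalence = record
      { refl = λ _ → ≈-refl
      ; sym = λ p 𝔄 → ≈-sym (p 𝔄)
      ; trans = λ p q 𝔄 → ≈-trans (p 𝔄) (q 𝔄) } }

  -- (3) liftings of the symmetric comonoidal monad to (X^!, ⊗^m, (K, m_K)).
  -- A functor T̃ on X^! with U^! T̃ = T U^! consists of a !-coalgebra
  -- structure on TA for every !-coalgebra (A, ω), such that Tf is a
  -- coalgebra morphism for every coalgebra morphism f.  The components of
  -- the lifted structure are the coalgebra morphisms with underlying maps
  -- μ_A, η_A, n_{A,B}, n_K.

  record LiftCoact : Set (o ⊔ ℓ ⊔ r) where
    field
      coact         : (ℭ : C.Coalg) → T₀ (C.car ℭ) ⇒ !₀ (T₀ (C.car ℭ))
      coact-isCoalg : (ℭ : C.Coalg) → C.IsCoalg (coact ℭ)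

  liftT : LiftCoact → C.Coalg → C.Coalg
  liftT L ℭ = C.coalg (T₀ (C.car ℭ)) (LiftCoact.coact L ℭ) (LiftCoact.coact-isCoalg L ℭ)

  record LiftCHoms (L : LiftCoact) : Set (o ⊔ ℓ ⊔ r) where
    private
      T̃ = liftT L
    field
      T-hom  : ∀ {ℭ 𝔇} (f : C.CoalgHom ℭ 𝔇) → C.IsCoalgHom (T̃ ℭ) (T̃ 𝔇) (T₁ (C.hom f))
      μ-hom  : ∀ ℭ → C.IsCoalgHom (T̃ (T̃ ℭ)) (T̃ ℭ) μ
      η-hom  : ∀ ℭ → C.IsCoalgHom ℭ (T̃ ℭ) η
      n-hom  : ∀ ℭ 𝔇 → C.IsCoalgHom (T̃ (ℭ C.⊗ᶜ 𝔇)) (T̃ ℭ C.⊗ᶜ T̃ 𝔇) n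
      nK-hom : C.IsCoalgHom (T̃ C.Kᶜ) C.Kᶜ nK

  liftedSCMData : (L : LiftCoact) → LiftCHoms L → SCMData C.X!
  liftedSCMData L H = record
    { T = record
      { F₀ = liftT L
      ; F₁ = λ f → C.coalgHom (T₁ (C.hom f)) (T-hom f)
      ; identity = 𝕋.identity
      ; homomorphism = 𝕋.homomorphism
      ; F-resp-≈ = 𝕋.F-resp-≈
      }
    ; μ  = λ {ℭ} → C.coalgHom μ (μ-hom ℭ)
    ; η  = λ {ℭ} → C.coalgHom η (η-hom ℭ)
    ; n  = λ {ℭ 𝔇} → C.coalgHom n (n-hom ℭ 𝔇)
    ; nK = C.coalgHom nK nK-hom
    }
    where open LiftCHoms H

  record LiftedSCM : Set (o ⊔ ℓ ⊔ r) where
    field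
      coacts : LiftCoact
      homs   : LiftCHoms coacts
      isSCM  : IsSCM C.X! (liftedSCMData coacts homs)
    open LiftCoact coacts public

  LiftedSCM-setoid : Setoid (o ⊔ ℓ ⊔ r) (o ⊔ ℓ ⊔ r)
  LiftedSCM-setoid = record
    { Carrier = LiftedSCM
    ; _≈_ = λ L L′ → ∀ ℭ → LiftedSCM.coact L ℭ ≈ LiftedSCM.coact L′ ℭ
    ; isEquivalence = record
      { refl = λ _ → ≈-refl
      ; sym = λ p ℭ → ≈-sym (p ℭ)
      ; trans = λ p q ℭ → ≈-trans (p ℭ) (q ℭ) } }

-- A law λ : T! ⇒ !T lifts ! to algebras by (A, ν) ↦ (!A, !ν ∘ λ) and T to
-- coalgebras by (A, ω) ↦ (TA, λ ∘ Tω).  Conversely λ is recovered from a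
-- lifting of ! as the action on !̃(TA, μ) precomposed with T!η, and from a
-- lifting of T as the coaction on T̃(!A, δ) postcomposed with !Tε; the axioms
-- of a law then say exactly that the structure maps are (co)algebra morphisms.
-- The one step that is not bookkeeping is that a law makes e and Δ algebra
-- morphisms.  Among !-coalgebras (K, m_K) is terminal and (!A, δ) ⊗ (!B, δ) is
-- the product of the cofree coalgebras, and the two sides of e ∘ λ = n_K ∘ Te
-- and of Δ ∘ λ = (λ ⊗ λ) ∘ n ∘ TΔ are coalgebra morphisms out of T̃(!A, δ)
-- into these, agreeing after the projections.

module Submission where

open import Defs
open import Data.Product using (_×_; _,_)
open import Function.Bundles using (Inverse)

module CategoryProps {o ℓ e} (𝒞 : Category o ℓ e) where
  open Category 𝒞

  pullˡ : ∀ {W U V Y} {a : V ⇒ Y} {b : U ⇒ V} {c : U ⇒ Y} {f : W ⇒ U} →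
          a ∘ b ≈ c → a ∘ (b ∘ f) ≈ c ∘ f
  pullˡ p = ≈-trans sym-assoc (p ⟩∘⟨refl)

  pushˡ : ∀ {W U V Y} {a : V ⇒ Y} {b : U ⇒ V} {c : U ⇒ Y} {f : W ⇒ U} →
          c ≈ a ∘ b → c ∘ f ≈ a ∘ (b ∘ f)
  pushˡ p = ≈-sym (pullˡ (≈-sym p))

  pullʳ : ∀ {W U V Y} {a : V ⇒ Y} {b : U ⇒ V} {c : W ⇒ V} {f : W ⇒ U} →
          b ∘ f ≈ c → (a ∘ b) ∘ f ≈ a ∘ c
  pullʳ p = ≈-trans assoc (refl⟩∘⟨ p)

  pull₃ : ∀ {W U₁ U₂ V Y} {a : V ⇒ Y} {b : U₂ ⇒ V} {c : U₁ ⇒ U₂} {x : U₁ ⇒ Y} {f : W ⇒ U₁} →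
          a ∘ (b ∘ c) ≈ x → a ∘ (b ∘ (c ∘ f)) ≈ x ∘ f
  pull₃ p = ≈-trans (refl⟩∘⟨ sym-assoc) (pullˡ p)

  elimˡ : ∀ {U V} {a : V ⇒ V} {f : U ⇒ V} → a ≈ id → a ∘ f ≈ f
  elimˡ p = ≈-trans (p ⟩∘⟨refl) identityˡ

  elimʳ : ∀ {U V} {a : U ⇒ U} {f : U ⇒ V} → a ≈ id → f ∘ a ≈ f
  elimʳ p = ≈-trans (refl⟩∘⟨ p) identityʳ

  cancelˡ : ∀ {W U V} {a : V ⇒ U} {b : U ⇒ V} {f : W ⇒ U} → a ∘ b ≈ id → a ∘ (b ∘ f) ≈ f
  cancelˡ p = ≈-trans (pullˡ p) identityˡ

  id-comm : ∀ {U V} {f : U ⇒ V} → id ∘ f ≈ f ∘ id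
  id-comm = ≈-trans identityˡ (≈-sym identityʳ)

module FunctorProps {o ℓ e o′ ℓ′ e′} {𝒞 : Category o ℓ e} {𝒟 : Category o′ ℓ′ e′}
       (F : Functor 𝒞 𝒟) where
  private
    module 𝒞 = Category 𝒞
    module 𝒟 = Category 𝒟
  open Functor F

  resp-id : ∀ {A} {f : A 𝒞.⇒ A} → f 𝒞.≈ 𝒞.id → F₁ f 𝒟.≈ 𝒟.id
  resp-id p = 𝒟.≈-trans (F-resp-≈ p) identity

  fuse : ∀ {A B C} {f : B 𝒞.⇒ C} {g : A 𝒞.⇒ B} → F₁ f 𝒟.∘ F₁ g 𝒟.≈ F₁ (f 𝒞.∘ g)
  fuse = 𝒟.≈-sym homomorphism

  fuse₃ : ∀ {A B C D} {f : C 𝒞.⇒ D} {g : B 𝒞.⇒ C} {h : A 𝒞.⇒ B} →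
          F₁ f 𝒟.∘ (F₁ g 𝒟.∘ F₁ h) 𝒟.≈ F₁ (f 𝒞.∘ (g 𝒞.∘ h))
  fuse₃ = 𝒟.≈-sym (𝒟.≈-trans homomorphism (𝒟.refl⟩∘⟨ homomorphism))

  resp-inverse : ∀ {A B} {f : B 𝒞.⇒ A} {g : A 𝒞.⇒ B} → f 𝒞.∘ g 𝒞.≈ 𝒞.id → F₁ f 𝒟.∘ F₁ g 𝒟.≈ 𝒟.id
  resp-inverse p = 𝒟.≈-trans fuse (resp-id p)

  resp-square : ∀ {A B C D} {f : B 𝒞.⇒ D} {g : A 𝒞.⇒ B} {h : C 𝒞.⇒ D} {k : A 𝒞.⇒ C} →
                f 𝒞.∘ g 𝒞.≈ h 𝒞.∘ k → F₁ f 𝒟.∘ F₁ g 𝒟.≈ F₁ h 𝒟.∘ F₁ k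
  resp-square p = 𝒟.≈-trans fuse (𝒟.≈-trans (F-resp-≈ p) homomorphism)

module SymMonProps {o ℓ r} (X : SymMonCat o ℓ r) where
  open SymMonCat X
  open CategoryProps cat
  open HomReasoning

  ⊗-resp-id : ∀ {A B} {f : A ⇒ A} {g : B ⇒ B} → f ≈ id → g ≈ id → f ⊗₁ g ≈ id
  ⊗-resp-id p q = ≈-trans (⊗-resp p q) ⊗-id

  ⊗-inverse : ∀ {A B C D} {f : A ⇒ B} {f′ : B ⇒ A} {g : C ⇒ D} {g′ : D ⇒ C} →
              f′ ∘ f ≈ id → g′ ∘ g ≈ id → (f′ ⊗₁ g′) ∘ (f ⊗₁ g) ≈ id
  ⊗-inverse p q = ≈-trans (≈-sym ⊗-∘) (⊗-resp-id p q)

  ru⁻¹-unique : ∀ {A} {g : A ⇒ A ⊗₀ K} → ru ∘ g ≈ id → g ≈ ru⁻¹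
  ru⁻¹-unique p = ≈-trans (≈-sym (elimˡ ru-isoˡ)) (≈-trans (pullʳ p) identityʳ)

  lu⁻¹-unique : ∀ {A} {g : A ⇒ K ⊗₀ A} → lu ∘ g ≈ id → g ≈ lu⁻¹
  lu⁻¹-unique p = ≈-trans (≈-sym (elimˡ lu-isoˡ)) (≈-trans (pullʳ p) identityʳ)

  ru-⊗ : ∀ {A B C} {f : A ⇒ B} {g : C ⇒ K} → ru ∘ (f ⊗₁ g) ≈ f ∘ (ru ∘ (id ⊗₁ g))
  ru-⊗ = ≈-trans (refl⟩∘⟨ ⊗-lr) (≈-trans (pullˡ ru-nat) assoc)
    where open SMCProps X

  lu-⊗ : ∀ {A B C} {f : A ⇒ B} {g : C ⇒ K} → lu ∘ (g ⊗₁ f) ≈ f ∘ (lu ∘ (g ⊗₁ id))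
  lu-⊗ = ≈-trans (refl⟩∘⟨ ⊗-rl) (≈-trans (pullˡ lu-nat) assoc)
    where open SMCProps X

  α⁻¹-nat : ∀ {A B C D E F} {f : A ⇒ B} {g : C ⇒ D} {h : E ⇒ F} →
            α⁻¹ ∘ (f ⊗₁ (g ⊗₁ h)) ≈ ((f ⊗₁ g) ⊗₁ h) ∘ α⁻¹
  α⁻¹-nat {f = f} {g} {h} = begin
    α⁻¹ ∘ (f ⊗₁ (g ⊗₁ h))               ≈⟨ refl⟩∘⟨ elimʳ α-isoʳ ⟨
    α⁻¹ ∘ ((f ⊗₁ (g ⊗₁ h)) ∘ (α ∘ α⁻¹)) ≈⟨ refl⟩∘⟨ pullˡ (≈-sym α-nat) ⟩
    α⁻¹ ∘ ((α ∘ ((f ⊗₁ g) ⊗₁ h)) ∘ α⁻¹) ≈⟨ refl⟩∘⟨ assoc ⟩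
    α⁻¹ ∘ (α ∘ (((f ⊗₁ g) ⊗₁ h) ∘ α⁻¹)) ≈⟨ cancelˡ α-isoˡ ⟩
    ((f ⊗₁ g) ⊗₁ h) ∘ α⁻¹               ∎

  -- τ is  α⁻¹ ∘ (id ⊗₁ σ₁₂) ∘ α  on the nose.
  σ₁₂ : ∀ {A B C} → A ⊗₀ (B ⊗₀ C) ⇒ B ⊗₀ (A ⊗₀ C)
  σ₁₂ = α ∘ ((σ ⊗₁ id) ∘ α⁻¹)

  σ₁₂-nat : ∀ {A A′ B B′ C C′} {f : A ⇒ A′} {g : B ⇒ B′} {h : C ⇒ C′} →
            σ₁₂ ∘ (f ⊗₁ (g ⊗₁ h)) ≈ (g ⊗₁ (f ⊗₁ h)) ∘ σ₁₂
  σ₁₂-nat {f = f} {g} {h} = begin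
    (α ∘ ((σ ⊗₁ id) ∘ α⁻¹)) ∘ (f ⊗₁ (g ⊗₁ h)) ≈⟨ pullʳ (pullʳ α⁻¹-nat) ⟩
    α ∘ ((σ ⊗₁ id) ∘ (((f ⊗₁ g) ⊗₁ h) ∘ α⁻¹)) ≈⟨ refl⟩∘⟨ pullˡ (≈-sym ⊗-∘) ⟩
    α ∘ (((σ ∘ (f ⊗₁ g)) ⊗₁ (id ∘ h)) ∘ α⁻¹)  ≈⟨ refl⟩∘⟨ ⊗-resp σ-nat id-comm ⟩∘⟨refl ⟩
    α ∘ ((((g ⊗₁ f) ∘ σ) ⊗₁ (h ∘ id)) ∘ α⁻¹)  ≈⟨ refl⟩∘⟨ pushˡ ⊗-∘ ⟩
    α ∘ (((g ⊗₁ f) ⊗₁ h) ∘ ((σ ⊗₁ id) ∘ α⁻¹)) ≈⟨ pullˡ α-nat ⟩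
    ((g ⊗₁ (f ⊗₁ h)) ∘ α) ∘ ((σ ⊗₁ id) ∘ α⁻¹) ≈⟨ assoc ⟩
    (g ⊗₁ (f ⊗₁ h)) ∘ σ₁₂                     ∎

  σ₁₂-involutive : ∀ {A B C} → σ₁₂ {B} {A} {C} ∘ σ₁₂ {A} {B} {C} ≈ id
  σ₁₂-involutive = begin
    (α ∘ ((σ ⊗₁ id) ∘ α⁻¹)) ∘ (α ∘ ((σ ⊗₁ id) ∘ α⁻¹))
      ≈⟨ pullʳ (pullʳ (cancelˡ α-isoˡ)) ⟩
    α ∘ ((σ ⊗₁ id) ∘ ((σ ⊗₁ id) ∘ α⁻¹))
      ≈⟨ refl⟩∘⟨ cancelˡ (⊗-inverse σ-inv identityˡ) ⟩
    α ∘ α⁻¹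
      ≈⟨ α-isoʳ ⟩
    id ∎

  τ-nat : ∀ {A A′ B B′ C C′ D D′} {f : A ⇒ A′} {g : B ⇒ B′} {h : C ⇒ C′} {k : D ⇒ D′} →
          τ ∘ ((f ⊗₁ g) ⊗₁ (h ⊗₁ k)) ≈ ((f ⊗₁ h) ⊗₁ (g ⊗₁ k)) ∘ τ
  τ-nat {f = f} {g} {h} {k} = begin
    (α⁻¹ ∘ ((id ⊗₁ σ₁₂) ∘ α)) ∘ ((f ⊗₁ g) ⊗₁ (h ⊗₁ k)) ≈⟨ pullʳ (pullʳ α-nat) ⟩
    α⁻¹ ∘ ((id ⊗₁ σ₁₂) ∘ ((f ⊗₁ (g ⊗₁ (h ⊗₁ k))) ∘ α)) ≈⟨ refl⟩∘⟨ pullˡ (≈-sym ⊗-∘) ⟩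
    α⁻¹ ∘ (((id ∘ f) ⊗₁ (σ₁₂ ∘ (g ⊗₁ (h ⊗₁ k)))) ∘ α)  ≈⟨ refl⟩∘⟨ ⊗-resp id-comm σ₁₂-nat ⟩∘⟨refl ⟩
    α⁻¹ ∘ (((f ∘ id) ⊗₁ ((h ⊗₁ (g ⊗₁ k)) ∘ σ₁₂)) ∘ α)  ≈⟨ refl⟩∘⟨ pushˡ ⊗-∘ ⟩
    α⁻¹ ∘ ((f ⊗₁ (h ⊗₁ (g ⊗₁ k))) ∘ ((id ⊗₁ σ₁₂) ∘ α)) ≈⟨ pullˡ α⁻¹-nat ⟩
    (((f ⊗₁ h) ⊗₁ (g ⊗₁ k)) ∘ α⁻¹) ∘ ((id ⊗₁ σ₁₂) ∘ α) ≈⟨ assoc ⟩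
    ((f ⊗₁ h) ⊗₁ (g ⊗₁ k)) ∘ τ                         ∎

  τ-involutive : ∀ {A B C D} → τ {A} {C} {B} {D} ∘ τ {A} {B} {C} {D} ≈ id
  τ-involutive = begin
    (α⁻¹ ∘ ((id ⊗₁ σ₁₂) ∘ α)) ∘ (α⁻¹ ∘ ((id ⊗₁ σ₁₂) ∘ α))
      ≈⟨ pullʳ (pullʳ (cancelˡ α-isoʳ)) ⟩
    α⁻¹ ∘ ((id ⊗₁ σ₁₂) ∘ ((id ⊗₁ σ₁₂) ∘ α))
      ≈⟨ refl⟩∘⟨ cancelˡ (⊗-inverse identityˡ σ₁₂-involutive) ⟩
    α⁻¹ ∘ α
      ≈⟨ α-isoˡ ⟩
    id ∎

  -- By coherence shuffle is the identity; that it is an involution is all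
  -- we need, and this follows from τ-involutive alone.
  shuffle : ∀ {A B} → A ⊗₀ B ⇒ A ⊗₀ B
  shuffle = (ru ⊗₁ lu) ∘ (τ ∘ (ru⁻¹ ⊗₁ lu⁻¹))

  shuffle-involutive : ∀ {A B} → shuffle {A} {B} ∘ shuffle ≈ id
  shuffle-involutive = begin
    ((ru ⊗₁ lu) ∘ (τ ∘ (ru⁻¹ ⊗₁ lu⁻¹))) ∘ shuffle
      ≈⟨ pullʳ (pullʳ (cancelˡ (⊗-inverse ru-isoˡ lu-isoˡ))) ⟩
    (ru ⊗₁ lu) ∘ (τ ∘ (τ ∘ (ru⁻¹ ⊗₁ lu⁻¹)))
      ≈⟨ refl⟩∘⟨ cancelˡ τ-involutive ⟩
    (ru ⊗₁ lu) ∘ (ru⁻¹ ⊗₁ lu⁻¹)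
      ≈⟨ ⊗-inverse ru-isoʳ lu-isoʳ ⟩
    id ∎

module FreeAlgebraProps {o ℓ r} (X : SymMonCat o ℓ r) (𝕋 : SymComonoidalMonad X) where
  open SymMonCat X
  open SMCProps X
  open CategoryProps cat
  open SymComonoidalMonad 𝕋
  open FunctorProps T using (fuse₃)
  open EM X 𝕋
  open HomReasoning

  free : Obj → Alg
  free A = alg (T₀ A) μ (record { alg-μ = ≈-sym μ-assoc ; alg-η = μ-unitˡ })

  T₁ᵃ : ∀ {A B} → A ⇒ B → AlgHom (free A) (free B)
  T₁ᵃ f = algHom (T₁ f) (≈-sym μ-nat)

  μᵃ : ∀ {A} → AlgHom (free (T₀ A)) (free A)
  μᵃ = algHom μ (≈-sym μ-assoc)

  nᵃ : ∀ {A B} → AlgHom (free (A ⊗₀ B)) (free A ⊗ᵀ free B)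
  nᵃ = algHom n (≈-trans μ-n sym-assoc)

  nKᵃ : AlgHom (free K) Kᵀ
  nKᵃ = algHom nK μ-nK

  actᵃ : (𝔄 : Alg) → AlgHom (free (car 𝔄)) 𝔄
  actᵃ 𝔄 = algHom (act 𝔄) (IsAlg.alg-μ (isAlg 𝔄))

  n-ru-natural : ∀ {A B C} {g : B ⇒ K} {h : A ⇒ C ⊗₀ B} →
                 ru ∘ ((id ⊗₁ (nK ∘ T₁ g)) ∘ (n ∘ T₁ h)) ≈ T₁ (ru ∘ ((id ⊗₁ g) ∘ h))
  n-ru-natural {g = g} {h} = begin
    ru ∘ ((id ⊗₁ (nK ∘ T₁ g)) ∘ (n ∘ T₁ h))
      ≈⟨ refl⟩∘⟨ pushˡ split-r ⟩
    ru ∘ ((id ⊗₁ nK) ∘ ((id ⊗₁ T₁ g) ∘ (n ∘ T₁ h)))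
      ≈⟨ refl⟩∘⟨ refl⟩∘⟨ ⊗-resp (≈-sym identity) ≈-refl ⟩∘⟨refl ⟩
    ru ∘ ((id ⊗₁ nK) ∘ ((T₁ id ⊗₁ T₁ g) ∘ (n ∘ T₁ h)))
      ≈⟨ refl⟩∘⟨ refl⟩∘⟨ pullˡ (≈-sym n-nat) ⟩
    ru ∘ ((id ⊗₁ nK) ∘ ((n ∘ T₁ (id ⊗₁ g)) ∘ T₁ h))
      ≈⟨ refl⟩∘⟨ refl⟩∘⟨ assoc ⟩
    ru ∘ ((id ⊗₁ nK) ∘ (n ∘ (T₁ (id ⊗₁ g) ∘ T₁ h)))
      ≈⟨ pull₃ n-ru ⟩
    T₁ ru ∘ (T₁ (id ⊗₁ g) ∘ T₁ h)
      ≈⟨ fuse₃ ⟩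
    T₁ (ru ∘ ((id ⊗₁ g) ∘ h)) ∎

  n-lu-natural : ∀ {A B C} {g : B ⇒ K} {h : A ⇒ B ⊗₀ C} →
                 lu ∘ (((nK ∘ T₁ g) ⊗₁ id) ∘ (n ∘ T₁ h)) ≈ T₁ (lu ∘ ((g ⊗₁ id) ∘ h))
  n-lu-natural {g = g} {h} = begin
    lu ∘ (((nK ∘ T₁ g) ⊗₁ id) ∘ (n ∘ T₁ h))
      ≈⟨ refl⟩∘⟨ pushˡ split-l′ ⟩
    lu ∘ ((nK ⊗₁ id) ∘ ((T₁ g ⊗₁ id) ∘ (n ∘ T₁ h)))
      ≈⟨ refl⟩∘⟨ refl⟩∘⟨ ⊗-resp ≈-refl (≈-sym identity) ⟩∘⟨refl ⟩
    lu ∘ ((nK ⊗₁ id) ∘ ((T₁ g ⊗₁ T₁ id) ∘ (n ∘ T₁ h)))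
      ≈⟨ refl⟩∘⟨ refl⟩∘⟨ pullˡ (≈-sym n-nat) ⟩
    lu ∘ ((nK ⊗₁ id) ∘ ((n ∘ T₁ (g ⊗₁ id)) ∘ T₁ h))
      ≈⟨ refl⟩∘⟨ refl⟩∘⟨ assoc ⟩
    lu ∘ ((nK ⊗₁ id) ∘ (n ∘ (T₁ (g ⊗₁ id) ∘ T₁ h)))
      ≈⟨ pull₃ n-lu ⟩
    T₁ lu ∘ (T₁ (g ⊗₁ id) ∘ T₁ h)
      ≈⟨ fuse₃ ⟩
    T₁ (lu ∘ ((g ⊗₁ id) ∘ h)) ∎

module CoalgebraProps {o ℓ r} (X : SymMonCat o ℓ r) (𝔹 : MonoidalCoalgebraModality X) where
  open SymMonCat X
  open CategoryProps cat
  open SymMonProps X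
  open MonoidalCoalgebraModality 𝔹
  open CoEM X 𝔹
  open HomReasoning

  cofree : Obj → Coalg
  cofree A = coalg (!₀ A) δ (record { coalg-ε = δ-unitˡ ; coalg-δ = ≈-sym δ-assoc })

  !₁ᶜ : ∀ {A B} → A ⇒ B → CoalgHom (cofree A) (cofree B)
  !₁ᶜ f = coalgHom (!₁ f) δ-nat

  δᶜ : ∀ {A} → CoalgHom (cofree A) (cofree (!₀ A))
  δᶜ = coalgHom δ (≈-sym δ-assoc)

  mᶜ : ∀ {A B} → CoalgHom (cofree A ⊗ᶜ cofree B) (cofree (A ⊗₀ B))
  mᶜ = coalgHom m δ-m

  mKᶜ : CoalgHom Kᶜ (cofree K)
  mKᶜ = coalgHom mK δ-mK

  eᶜ : ∀ {A} → CoalgHom (cofree A) Kᶜ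
  eᶜ = coalgHom e (≈-sym !e-δ)

  Δᶜ : ∀ {A} → CoalgHom (cofree A) (cofree A ⊗ᶜ cofree A)
  Δᶜ = coalgHom Δ (≈-trans assoc (≈-sym !Δ-δ))

  coactᶜ : (ℭ : Coalg) → CoalgHom ℭ (cofree (car ℭ))
  coactᶜ ℭ = coalgHom (coact ℭ) (IsCoalg.coalg-δ (isCoalg ℭ))

  Kᶜ-unique : ∀ {ℭ} (f g : CoalgHom ℭ Kᶜ) → hom f ≈ hom g
  Kᶜ-unique {ℭ} f g = ≈-trans (≈e∘coact f) (≈-sym (≈e∘coact g))
    where
    ≈e∘coact : (h : CoalgHom ℭ Kᶜ) → hom h ≈ e ∘ coact ℭ
    ≈e∘coact h = begin
      hom h                      ≈⟨ elimˡ e-mK ⟨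
      (e ∘ mK) ∘ hom h           ≈⟨ pullʳ (comm h) ⟩
      e ∘ (!₁ (hom h) ∘ coact ℭ) ≈⟨ pullˡ e-nat ⟩
      e ∘ coact ℭ                ∎

  copy : (ℭ : Coalg) → car ℭ ⇒ car ℭ ⊗₀ car ℭ
  copy ℭ = (ε ⊗₁ ε) ∘ (Δ ∘ coact ℭ)

  copy-natural : ∀ {ℭ 𝔇} (f : CoalgHom ℭ 𝔇) → copy 𝔇 ∘ hom f ≈ (hom f ⊗₁ hom f) ∘ copy ℭ
  copy-natural {ℭ} {𝔇} (coalgHom f f-comm) = begin
    ((ε ⊗₁ ε) ∘ (Δ ∘ coact 𝔇)) ∘ f              ≈⟨ pullʳ (pullʳ f-comm) ⟩
    (ε ⊗₁ ε) ∘ (Δ ∘ (!₁ f ∘ coact ℭ))           ≈⟨ refl⟩∘⟨ ≈-trans (pullˡ Δ-nat) assoc ⟩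
    (ε ⊗₁ ε) ∘ ((!₁ f ⊗₁ !₁ f) ∘ (Δ ∘ coact ℭ)) ≈⟨ pullˡ (≈-sym ⊗-∘) ⟩
    ((ε ∘ !₁ f) ⊗₁ (ε ∘ !₁ f)) ∘ (Δ ∘ coact ℭ)  ≈⟨ ⊗-resp ε-nat ε-nat ⟩∘⟨refl ⟩
    ((f ∘ ε) ⊗₁ (f ∘ ε)) ∘ (Δ ∘ coact ℭ)        ≈⟨ pushˡ ⊗-∘ ⟩
    (f ⊗₁ f) ∘ copy ℭ                           ∎

  copy-⊗ᶜ : ∀ ℭ 𝔇 → copy (ℭ ⊗ᶜ 𝔇) ≈ τ ∘ (copy ℭ ⊗₁ copy 𝔇)
  copy-⊗ᶜ ℭ 𝔇 = begin
    (ε ⊗₁ ε) ∘ (Δ ∘ (m ∘ (a ⊗₁ b)))                     ≈⟨ refl⟩∘⟨ pullˡ Δ-m ⟩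
    (ε ⊗₁ ε) ∘ (((m ⊗₁ m) ∘ (τ ∘ (Δ ⊗₁ Δ))) ∘ (a ⊗₁ b)) ≈⟨ refl⟩∘⟨ assoc ⟩
    (ε ⊗₁ ε) ∘ ((m ⊗₁ m) ∘ ((τ ∘ (Δ ⊗₁ Δ)) ∘ (a ⊗₁ b))) ≈⟨ pullˡ (≈-sym ⊗-∘) ⟩
    ((ε ∘ m) ⊗₁ (ε ∘ m)) ∘ ((τ ∘ (Δ ⊗₁ Δ)) ∘ (a ⊗₁ b))  ≈⟨ ⊗-resp ε-m ε-m ⟩∘⟨ pullʳ (≈-sym ⊗-∘) ⟩
    ((ε ⊗₁ ε) ⊗₁ (ε ⊗₁ ε)) ∘ (τ ∘ ((Δ ∘ a) ⊗₁ (Δ ∘ b))) ≈⟨ pullˡ (≈-sym τ-nat) ⟩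
    (τ ∘ ((ε ⊗₁ ε) ⊗₁ (ε ⊗₁ ε))) ∘ ((Δ ∘ a) ⊗₁ (Δ ∘ b)) ≈⟨ pullʳ (≈-sym ⊗-∘) ⟩
    τ ∘ (copy ℭ ⊗₁ copy 𝔇)                              ∎
    where
    a = coact ℭ
    b = coact 𝔇

  copy-cofree : ∀ {A} → copy (cofree A) ≈ Δ
  copy-cofree =
    ≈-trans (refl⟩∘⟨ δ-Δ) (≈-trans (pullˡ (≈-sym ⊗-∘)) (elimˡ (⊗-resp-id δ-unitˡ δ-unitˡ)))

  π₁ : ∀ {A B} → !₀ A ⊗₀ !₀ B ⇒ !₀ A
  π₁ = ru ∘ (id ⊗₁ e)

  π₂ : ∀ {A B} → !₀ A ⊗₀ !₀ B ⇒ !₀ B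
  π₂ = lu ∘ (e ⊗₁ id)

  π₁-Δ : ∀ {A B} {f : A ⇒ !₀ B} → π₁ ∘ (Δ ∘ f) ≈ f
  π₁-Δ = ≈-trans assoc (≈-trans (pull₃ Δ-counitʳ) identityˡ)

  π₂-Δ : ∀ {A B} {f : A ⇒ !₀ B} → π₂ ∘ (Δ ∘ f) ≈ f
  π₂-Δ = ≈-trans assoc (≈-trans (pull₃ Δ-counitˡ) identityˡ)

  π-copy-cofree-⊗ᶜ : ∀ {A B} → (π₁ ⊗₁ π₂) ∘ copy (cofree A ⊗ᶜ cofree B) ≈ shuffle
  π-copy-cofree-⊗ᶜ {A} {B} = begin
    (π₁ ⊗₁ π₂) ∘ copy (cofree A ⊗ᶜ cofree B)
      ≈⟨ refl⟩∘⟨ copy-⊗ᶜ (cofree A) (cofree B) ⟩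
    (π₁ ⊗₁ π₂) ∘ (τ ∘ (copy (cofree A) ⊗₁ copy (cofree B)))
      ≈⟨ ⊗-∘ ⟩∘⟨ refl⟩∘⟨ ⊗-resp copy-cofree copy-cofree ⟩
    ((ru ⊗₁ lu) ∘ ((id ⊗₁ e) ⊗₁ (e ⊗₁ id))) ∘ (τ ∘ (Δ ⊗₁ Δ))
      ≈⟨ pullʳ (pullˡ (≈-sym τ-nat)) ⟩
    (ru ⊗₁ lu) ∘ ((τ ∘ ((id ⊗₁ e) ⊗₁ (e ⊗₁ id))) ∘ (Δ ⊗₁ Δ))
      ≈⟨ refl⟩∘⟨ pullʳ (≈-sym ⊗-∘) ⟩
    (ru ⊗₁ lu) ∘ (τ ∘ (((id ⊗₁ e) ∘ Δ) ⊗₁ ((e ⊗₁ id) ∘ Δ)))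
      ≈⟨ refl⟩∘⟨ refl⟩∘⟨ ⊗-resp (ru⁻¹-unique Δ-counitʳ) (lu⁻¹-unique Δ-counitˡ) ⟩
    shuffle ∎

  π-jointly-monic : ∀ {ℭ A B} (f g : CoalgHom ℭ (cofree A ⊗ᶜ cofree B)) →
                    π₁ ∘ hom f ≈ π₁ ∘ hom g → π₂ ∘ hom f ≈ π₂ ∘ hom g → hom f ≈ hom g
  π-jointly-monic {ℭ} {A} {B} f g p₁ p₂ = begin
    hom f                                               ≈⟨ cancelˡ shuffle-involutive ⟨
    shuffle ∘ (shuffle ∘ hom f)                         ≈⟨ refl⟩∘⟨ shuffle-∘ f ⟩
    shuffle ∘ (((π₁ ∘ hom f) ⊗₁ (π₂ ∘ hom f)) ∘ copy ℭ) ≈⟨ refl⟩∘⟨ ⊗-resp p₁ p₂ ⟩∘⟨refl ⟩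
    shuffle ∘ (((π₁ ∘ hom g) ⊗₁ (π₂ ∘ hom g)) ∘ copy ℭ) ≈⟨ refl⟩∘⟨ shuffle-∘ g ⟨
    shuffle ∘ (shuffle ∘ hom g)                         ≈⟨ cancelˡ shuffle-involutive ⟩
    hom g                                               ∎
    where
    shuffle-∘ : (h : CoalgHom ℭ (cofree A ⊗ᶜ cofree B)) →
                shuffle ∘ hom h ≈ ((π₁ ∘ hom h) ⊗₁ (π₂ ∘ hom h)) ∘ copy ℭ
    shuffle-∘ h = begin
      shuffle ∘ hom h                                    ≈⟨ π-copy-cofree-⊗ᶜ ⟩∘⟨refl ⟨
      ((π₁ ⊗₁ π₂) ∘ copy (cofree A ⊗ᶜ cofree B)) ∘ hom h ≈⟨ pullʳ (copy-natural h) ⟩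
      (π₁ ⊗₁ π₂) ∘ ((hom h ⊗₁ hom h) ∘ copy ℭ)           ≈⟨ pullˡ (≈-sym ⊗-∘) ⟩
      ((π₁ ∘ hom h) ⊗₁ (π₂ ∘ hom h)) ∘ copy ℭ            ∎

module Bijections {o ℓ r} (X : SymMonCat o ℓ r)
       (𝕋 : SymComonoidalMonad X) (𝔹 : MonoidalCoalgebraModality X) where
  open SymMonCat X
  open CategoryProps cat
  open SymMonProps X
  open Correspondence X 𝕋 𝔹
  private
    module 𝕋 = SymComonoidalMonad 𝕋
    module 𝔹 = MonoidalCoalgebraModality 𝔹
    module A = EM X 𝕋
    module C = CoEM X 𝔹
  open 𝕋 using (T₀; T₁; μ; η; n; nK) renaming (homomorphism to T-split; F-resp-≈ to T-resp)
  open 𝔹 using (!₀; !₁; δ; ε; m; mK; Δ; e) renaming (homomorphism to !-split; F-resp-≈ to !-resp)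
  open FunctorProps 𝕋.T using () renaming
    ( resp-id to T-resp-id; resp-inverse to T-resp-inverse; fuse to T-fuse; fuse₃ to T-fuse₃
    ; resp-square to T-resp-square)
  open FunctorProps 𝔹.Bang using () renaming
    ( resp-inverse to !-resp-inverse; fuse to !-fuse; fuse₃ to !-fuse₃
    ; resp-square to !-resp-square)
  open FreeAlgebraProps X 𝕋
  open CoalgebraProps X 𝔹
  open Category C.CoEMcat using () renaming (_∘_ to _∘ᶜ_)
  open SymMonoidal C.CoEMmon using () renaming (_⊗₁_ to _⊗₁ᶜ_)
  open HomReasoning

  -- Equality of (co)algebra morphisms is equality of underlying maps, so the
  -- axioms of a lifting are literally those of the original structure.
  liftIsMCM : (L : LiftAct) (H : LiftHoms L) → IsMCM A.Xᵀ (liftedMCMData L H)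
  liftIsMCM L H = record { IsMCM 𝔹.isMCM }

  liftIsSCM : (L : LiftCoact) (H : LiftCHoms L) → IsSCM C.X! (liftedSCMData L H)
  liftIsSCM L H = record { IsSCM 𝕋.isSCM }

  module DistLaw⇒Lifts (L : SymMonMixedDistLaw) where
    open SymMonMixedDistLaw L

    coactᵀ : (ℭ : C.Coalg) → T₀ (C.car ℭ) ⇒ !₀ (T₀ (C.car ℭ))
    coactᵀ ℭ = dist ∘ T₁ (C.coact ℭ)

    coactᵀ-isCoalg : (ℭ : C.Coalg) → C.IsCoalg (coactᵀ ℭ)
    coactᵀ-isCoalg (C.coalg B ω isC) = record
      { coalg-ε = ≈-trans (pullˡ dist-ε) (T-resp-inverse coalg-ε)
      ; coalg-δ = begin
          δ ∘ (dist ∘ T₁ ω)                     ≈⟨ pullˡ dist-δ ⟩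
          (!₁ dist ∘ (dist ∘ T₁ δ)) ∘ T₁ ω      ≈⟨ pullʳ (pullʳ (T-resp-square coalg-δ)) ⟩
          !₁ dist ∘ (dist ∘ (T₁ (!₁ ω) ∘ T₁ ω)) ≈⟨ refl⟩∘⟨ pullˡ dist-nat ⟩
          !₁ dist ∘ ((!₁ (T₁ ω) ∘ dist) ∘ T₁ ω) ≈⟨ refl⟩∘⟨ assoc ⟩
          !₁ dist ∘ (!₁ (T₁ ω) ∘ (dist ∘ T₁ ω)) ≈⟨ pullˡ !-fuse ⟩
          !₁ (dist ∘ T₁ ω) ∘ (dist ∘ T₁ ω)      ∎ }
      where open C.IsCoalg isC

    liftCoact : LiftCoact
    liftCoact = record { coact = coactᵀ ; coact-isCoalg = coactᵀ-isCoalg }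

    T̃ : C.Coalg → C.Coalg
    T̃ = liftT liftCoact

    liftCHoms : LiftCHoms liftCoact
    liftCHoms = record
      { T-hom = λ {ℭ} {𝔇} (C.coalgHom f f-comm) → begin
          (dist ∘ T₁ (C.coact 𝔇)) ∘ T₁ f      ≈⟨ pullʳ (T-resp-square f-comm) ⟩
          dist ∘ (T₁ (!₁ f) ∘ T₁ (C.coact ℭ)) ≈⟨ pullˡ dist-nat ⟩
          (!₁ (T₁ f) ∘ dist) ∘ T₁ (C.coact ℭ) ≈⟨ assoc ⟩
          !₁ (T₁ f) ∘ coactᵀ ℭ                ∎
      ; μ-hom = λ ℭ → begin
          (dist ∘ T₁ (C.coact ℭ)) ∘ μ                     ≈⟨ pullʳ (≈-sym 𝕋.μ-nat) ⟩
          dist ∘ (μ ∘ T₁ (T₁ (C.coact ℭ)))                ≈⟨ pullˡ dist-μ ⟩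
          (!₁ μ ∘ (dist ∘ T₁ dist)) ∘ T₁ (T₁ (C.coact ℭ)) ≈⟨ pullʳ (pullʳ T-fuse) ⟩
          !₁ μ ∘ coactᵀ (T̃ ℭ)                            ∎
      ; η-hom = λ ℭ → ≈-trans (pullʳ (≈-sym 𝕋.η-nat)) (pullˡ dist-η)
      ; n-hom = λ ℭ 𝔇 → begin
          (m ∘ (coactᵀ ℭ ⊗₁ coactᵀ 𝔇)) ∘ n
            ≈⟨ pullʳ (pushˡ ⊗-∘) ⟩
          m ∘ ((dist ⊗₁ dist) ∘ ((T₁ (C.coact ℭ) ⊗₁ T₁ (C.coact 𝔇)) ∘ n))
            ≈⟨ refl⟩∘⟨ refl⟩∘⟨ 𝕋.n-nat ⟨
          m ∘ ((dist ⊗₁ dist) ∘ (n ∘ T₁ (C.coact ℭ ⊗₁ C.coact 𝔇)))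
            ≈⟨ pull₃ (≈-sym dist-m) ⟩
          (!₁ n ∘ (dist ∘ T₁ m)) ∘ T₁ (C.coact ℭ ⊗₁ C.coact 𝔇)
            ≈⟨ pullʳ (pullʳ T-fuse) ⟩
          !₁ n ∘ coactᵀ (ℭ C.⊗ᶜ 𝔇) ∎
      ; nK-hom = ≈-sym dist-mK
      }

    liftedSCM : LiftedSCM
    liftedSCM = record
      { coacts = liftCoact ; homs = liftCHoms ; isSCM = liftIsSCM liftCoact liftCHoms }

    open LiftCHoms liftCHoms

    T̃₁ : ∀ {ℭ 𝔇} → C.CoalgHom ℭ 𝔇 → C.CoalgHom (T̃ ℭ) (T̃ 𝔇)
    T̃₁ f = C.coalgHom (T₁ (C.hom f)) (T-hom f)

    distᶜ : ∀ {A} → C.CoalgHom (T̃ (cofree A)) (cofree (T₀ A))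
    distᶜ = C.coalgHom dist dist-δ

    dist-e : ∀ {A} → e ∘ dist {A} ≈ nK ∘ T₁ e
    dist-e = Kᶜ-unique (eᶜ ∘ᶜ distᶜ) (C.coalgHom nK nK-hom ∘ᶜ T̃₁ eᶜ)

    π₁-T̃Δ : ∀ {A} → π₁ ∘ ((dist ⊗₁ dist) ∘ (n ∘ T₁ (Δ {A}))) ≈ dist
    π₁-T̃Δ = begin
      (ru ∘ (id ⊗₁ e)) ∘ ((dist ⊗₁ dist) ∘ (n ∘ T₁ Δ))
        ≈⟨ pullʳ (pullˡ (≈-sym ⊗-∘)) ⟩
      ru ∘ (((id ∘ dist) ⊗₁ (e ∘ dist)) ∘ (n ∘ T₁ Δ))
        ≈⟨ refl⟩∘⟨ ⊗-resp identityˡ dist-e ⟩∘⟨refl ⟩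
      ru ∘ ((dist ⊗₁ (nK ∘ T₁ e)) ∘ (n ∘ T₁ Δ))
        ≈⟨ pullˡ ru-⊗ ⟩
      (dist ∘ (ru ∘ (id ⊗₁ (nK ∘ T₁ e)))) ∘ (n ∘ T₁ Δ)
        ≈⟨ pullʳ assoc ⟩
      dist ∘ (ru ∘ ((id ⊗₁ (nK ∘ T₁ e)) ∘ (n ∘ T₁ Δ)))
        ≈⟨ refl⟩∘⟨ n-ru-natural ⟩
      dist ∘ T₁ (ru ∘ ((id ⊗₁ e) ∘ Δ))
        ≈⟨ elimʳ (T-resp-id 𝔹.Δ-counitʳ) ⟩
      dist ∎

    π₂-T̃Δ : ∀ {A} → π₂ ∘ ((dist ⊗₁ dist) ∘ (n ∘ T₁ (Δ {A}))) ≈ dist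
    π₂-T̃Δ = begin
      (lu ∘ (e ⊗₁ id)) ∘ ((dist ⊗₁ dist) ∘ (n ∘ T₁ Δ))
        ≈⟨ pullʳ (pullˡ (≈-sym ⊗-∘)) ⟩
      lu ∘ (((e ∘ dist) ⊗₁ (id ∘ dist)) ∘ (n ∘ T₁ Δ))
        ≈⟨ refl⟩∘⟨ ⊗-resp dist-e identityˡ ⟩∘⟨refl ⟩
      lu ∘ (((nK ∘ T₁ e) ⊗₁ dist) ∘ (n ∘ T₁ Δ))
        ≈⟨ pullˡ lu-⊗ ⟩
      (dist ∘ (lu ∘ ((nK ∘ T₁ e) ⊗₁ id))) ∘ (n ∘ T₁ Δ)
        ≈⟨ pullʳ assoc ⟩
      dist ∘ (lu ∘ (((nK ∘ T₁ e) ⊗₁ id) ∘ (n ∘ T₁ Δ)))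
        ≈⟨ refl⟩∘⟨ n-lu-natural ⟩
      dist ∘ T₁ (lu ∘ ((e ⊗₁ id) ∘ Δ))
        ≈⟨ elimʳ (T-resp-id 𝔹.Δ-counitˡ) ⟩
      dist ∎

    dist-Δ : ∀ {A} → Δ ∘ dist {A} ≈ (dist ⊗₁ dist) ∘ (n ∘ T₁ Δ)
    dist-Δ {A} =
      π-jointly-monic (Δᶜ ∘ᶜ distᶜ) ((distᶜ ⊗₁ᶜ distᶜ) ∘ᶜ (nᶜ ∘ᶜ T̃₁ Δᶜ))
        (≈-trans π₁-Δ (≈-sym π₁-T̃Δ)) (≈-trans π₂-Δ (≈-sym π₂-T̃Δ))
      where
      nᶜ : C.CoalgHom (T̃ (cofree A C.⊗ᶜ cofree A)) (T̃ (cofree A) C.⊗ᶜ T̃ (cofree A))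
      nᶜ = C.coalgHom n (n-hom (cofree A) (cofree A))

    act! : (𝔄 : A.Alg) → T₀ (!₀ (A.car 𝔄)) ⇒ !₀ (A.car 𝔄)
    act! 𝔄 = !₁ (A.act 𝔄) ∘ dist

    act!-isAlg : (𝔄 : A.Alg) → A.IsAlg (act! 𝔄)
    act!-isAlg (A.alg B ν isA) = record
      { alg-μ = begin
          (!₁ ν ∘ dist) ∘ μ                     ≈⟨ pullʳ dist-μ ⟩
          !₁ ν ∘ (!₁ μ ∘ (dist ∘ T₁ dist))      ≈⟨ pullˡ (!-resp-square alg-μ) ⟩
          (!₁ ν ∘ !₁ (T₁ ν)) ∘ (dist ∘ T₁ dist) ≈⟨ pullʳ (pullˡ (≈-sym dist-nat)) ⟩
          !₁ ν ∘ ((dist ∘ T₁ (!₁ ν)) ∘ T₁ dist) ≈⟨ refl⟩∘⟨ pullʳ T-fuse ⟩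
          !₁ ν ∘ (dist ∘ T₁ (!₁ ν ∘ dist))      ≈⟨ sym-assoc ⟩
          (!₁ ν ∘ dist) ∘ T₁ (!₁ ν ∘ dist)      ∎
      ; alg-η = ≈-trans (pullʳ dist-η) (!-resp-inverse alg-η) }
      where open A.IsAlg isA

    liftAct : LiftAct
    liftAct = record { act = act! ; act-isAlg = act!-isAlg }

    liftHoms : LiftHoms liftAct
    liftHoms = record
      { !-hom = λ {𝔄} {𝔅} (A.algHom f f-comm) → begin
          !₁ f ∘ (!₁ (A.act 𝔄) ∘ dist)      ≈⟨ pullˡ (!-resp-square f-comm) ⟩
          (!₁ (A.act 𝔅) ∘ !₁ (T₁ f)) ∘ dist ≈⟨ pullʳ (≈-sym dist-nat) ⟩
          !₁ (A.act 𝔅) ∘ (dist ∘ T₁ (!₁ f)) ≈⟨ sym-assoc ⟩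
          act! 𝔅 ∘ T₁ (!₁ f)                ∎
      ; δ-hom = λ 𝔄 → begin
          δ ∘ (!₁ (A.act 𝔄) ∘ dist)                     ≈⟨ pullˡ 𝔹.δ-nat ⟩
          (!₁ (!₁ (A.act 𝔄)) ∘ δ) ∘ dist                ≈⟨ pullʳ dist-δ ⟩
          !₁ (!₁ (A.act 𝔄)) ∘ (!₁ dist ∘ (dist ∘ T₁ δ)) ≈⟨ pullˡ !-fuse ⟩
          !₁ (act! 𝔄) ∘ (dist ∘ T₁ δ)                   ≈⟨ sym-assoc ⟩
          act! (lift! liftAct 𝔄) ∘ T₁ δ                 ∎
      ; ε-hom = λ 𝔄 → ≈-trans (pullˡ 𝔹.ε-nat) (pullʳ dist-ε)
      ; Δ-hom = λ 𝔄 → begin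
          Δ ∘ (!₁ (A.act 𝔄) ∘ dist)                                      ≈⟨ pullˡ 𝔹.Δ-nat ⟩
          ((!₁ (A.act 𝔄) ⊗₁ !₁ (A.act 𝔄)) ∘ Δ) ∘ dist                    ≈⟨ pullʳ dist-Δ ⟩
          (!₁ (A.act 𝔄) ⊗₁ !₁ (A.act 𝔄)) ∘ ((dist ⊗₁ dist) ∘ (n ∘ T₁ Δ)) ≈⟨ pullˡ (≈-sym ⊗-∘) ⟩
          (act! 𝔄 ⊗₁ act! 𝔄) ∘ (n ∘ T₁ Δ)                                ≈⟨ sym-assoc ⟩
          ((act! 𝔄 ⊗₁ act! 𝔄) ∘ n) ∘ T₁ Δ                                ∎
      ; e-hom = λ 𝔄 → ≈-trans (pullˡ 𝔹.e-nat) dist-e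
      ; m-hom = λ 𝔄 𝔅 → begin
          m ∘ ((act! 𝔄 ⊗₁ act! 𝔅) ∘ n)                                ≈⟨ refl⟩∘⟨ pushˡ ⊗-∘ ⟩
          m ∘ ((!₁ (A.act 𝔄) ⊗₁ !₁ (A.act 𝔅)) ∘ ((dist ⊗₁ dist) ∘ n)) ≈⟨ pullˡ 𝔹.m-nat ⟩
          (!₁ (A.act 𝔄 ⊗₁ A.act 𝔅) ∘ m) ∘ ((dist ⊗₁ dist) ∘ n)        ≈⟨ pullʳ (≈-sym dist-m) ⟩
          !₁ (A.act 𝔄 ⊗₁ A.act 𝔅) ∘ (!₁ n ∘ (dist ∘ T₁ m))            ≈⟨ pullˡ !-fuse ⟩
          !₁ ((A.act 𝔄 ⊗₁ A.act 𝔅) ∘ n) ∘ (dist ∘ T₁ m)               ≈⟨ sym-assoc ⟩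
          act! (𝔄 A.⊗ᵀ 𝔅) ∘ T₁ m                                      ∎
      ; mK-hom = ≈-sym (≈-trans assoc dist-mK)
      }

    liftedMCM : LiftedMCM
    liftedMCM = record
      { acts = liftAct ; homs = liftHoms ; isMCM = liftIsMCM liftAct liftHoms }

  module LiftedMCM⇒DistLaw (Lm : LiftedMCM) where
    open LiftedMCM Lm using (acts; act; act-isAlg; homs)
    open LiftHoms homs

    !̃ : A.Alg → A.Alg
    !̃ = lift! acts

    dist : ∀ {B} → T₀ (!₀ B) ⇒ !₀ (T₀ B)
    dist {B} = act (free B) ∘ T₁ (!₁ η)

    dist-isAlgHom : ∀ {B} → A.IsAlgHom (free (!₀ B)) (!̃ (free B)) dist
    dist-isAlgHom {B} = begin
      (act (free B) ∘ T₁ (!₁ η)) ∘ μ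
        ≈⟨ pullʳ (≈-sym 𝕋.μ-nat) ⟩
      act (free B) ∘ (μ ∘ T₁ (T₁ (!₁ η)))
        ≈⟨ pullˡ (A.IsAlg.alg-μ (act-isAlg (free B))) ⟩
      (act (free B) ∘ T₁ (act (free B))) ∘ T₁ (T₁ (!₁ η))
        ≈⟨ pullʳ T-fuse ⟩
      act (free B) ∘ T₁ dist ∎

    dist-η : ∀ {B} → dist {B} ∘ η ≈ !₁ η
    dist-η {B} = begin
      (act (free B) ∘ T₁ (!₁ η)) ∘ η ≈⟨ pullʳ (≈-sym 𝕋.η-nat) ⟩
      act (free B) ∘ (η ∘ !₁ η)      ≈⟨ pullˡ (A.IsAlg.alg-η (act-isAlg (free B))) ⟩
      id ∘ !₁ η                      ≈⟨ identityˡ ⟩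
      !₁ η                           ∎

    distLaw : SymMonMixedDistLaw
    distLaw = record
      { dist = dist
      ; dist-nat = λ {B} {B′} {f} → begin
          (act (free B′) ∘ T₁ (!₁ η)) ∘ T₁ (!₁ f)
            ≈⟨ pullʳ (T-resp-square (!-resp-square 𝕋.η-nat)) ⟩
          act (free B′) ∘ (T₁ (!₁ (T₁ f)) ∘ T₁ (!₁ η))
            ≈⟨ pullˡ (≈-sym (!-hom (T₁ᵃ f))) ⟩
          (!₁ (T₁ f) ∘ act (free B)) ∘ T₁ (!₁ η)
            ≈⟨ assoc ⟩
          !₁ (T₁ f) ∘ dist ∎
      ; dist-μ = λ {B} → ≈-trans dist-isAlgHom (≈-sym (begin
          !₁ μ ∘ ((act (free (T₀ B)) ∘ T₁ (!₁ η)) ∘ T₁ dist)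
            ≈⟨ refl⟩∘⟨ assoc ⟩
          !₁ μ ∘ (act (free (T₀ B)) ∘ (T₁ (!₁ η) ∘ T₁ dist))
            ≈⟨ pullˡ (!-hom μᵃ) ⟩
          (act (free B) ∘ T₁ (!₁ μ)) ∘ (T₁ (!₁ η) ∘ T₁ dist)
            ≈⟨ pullʳ T-fuse₃ ⟩
          act (free B) ∘ T₁ (!₁ μ ∘ (!₁ η ∘ dist))
            ≈⟨ refl⟩∘⟨ T-resp (cancelˡ (!-resp-inverse 𝕋.μ-unitˡ)) ⟩
          act (free B) ∘ T₁ dist ∎))
      ; dist-η = dist-η
      ; dist-δ = λ {B} → begin
          δ ∘ (act (free B) ∘ T₁ (!₁ η))
            ≈⟨ pullˡ (δ-hom (free B)) ⟩
          (act (!̃ (free B)) ∘ T₁ δ) ∘ T₁ (!₁ η)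
            ≈⟨ pullʳ (T-resp-square 𝔹.δ-nat) ⟩
          act (!̃ (free B)) ∘ (T₁ (!₁ (!₁ η)) ∘ T₁ δ)
            ≈⟨ refl⟩∘⟨ T-resp (!-resp dist-η) ⟩∘⟨refl ⟨
          act (!̃ (free B)) ∘ (T₁ (!₁ (dist ∘ η)) ∘ T₁ δ)
            ≈⟨ refl⟩∘⟨ pushˡ (≈-trans (T-resp !-split) T-split) ⟩
          act (!̃ (free B)) ∘ (T₁ (!₁ dist) ∘ (T₁ (!₁ η) ∘ T₁ δ))
            ≈⟨ pullˡ (≈-sym (!-hom (A.algHom dist dist-isAlgHom))) ⟩
          (!₁ dist ∘ act (free (!₀ B))) ∘ (T₁ (!₁ η) ∘ T₁ δ)
            ≈⟨ pullʳ sym-assoc ⟩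
          !₁ dist ∘ (dist ∘ T₁ δ) ∎
      ; dist-ε = λ {B} → begin
          ε ∘ (act (free B) ∘ T₁ (!₁ η)) ≈⟨ pullˡ (ε-hom (free B)) ⟩
          (μ ∘ T₁ ε) ∘ T₁ (!₁ η)         ≈⟨ pullʳ (T-resp-square 𝔹.ε-nat) ⟩
          μ ∘ (T₁ η ∘ T₁ ε)              ≈⟨ cancelˡ 𝕋.μ-unitʳ ⟩
          T₁ ε                           ∎
      ; dist-m = λ {B} {B′} → begin
          !₁ n ∘ ((act (free (B ⊗₀ B′)) ∘ T₁ (!₁ η)) ∘ T₁ m)
            ≈⟨ refl⟩∘⟨ assoc ⟩
          !₁ n ∘ (act (free (B ⊗₀ B′)) ∘ (T₁ (!₁ η) ∘ T₁ m))
            ≈⟨ pullˡ (!-hom nᵃ) ⟩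
          (act (free B A.⊗ᵀ free B′) ∘ T₁ (!₁ n)) ∘ (T₁ (!₁ η) ∘ T₁ m)
            ≈⟨ pullʳ T-fuse₃ ⟩
          act (free B A.⊗ᵀ free B′) ∘ T₁ (!₁ n ∘ (!₁ η ∘ m))
            ≈⟨ refl⟩∘⟨ T-resp !η-m ⟩
          act (free B A.⊗ᵀ free B′) ∘ T₁ (m ∘ (!₁ η ⊗₁ !₁ η))
            ≈⟨ refl⟩∘⟨ T-split ⟩
          act (free B A.⊗ᵀ free B′) ∘ (T₁ m ∘ T₁ (!₁ η ⊗₁ !₁ η))
            ≈⟨ pullˡ (≈-sym (m-hom (free B) (free B′))) ⟩
          (m ∘ ((act (free B) ⊗₁ act (free B′)) ∘ n)) ∘ T₁ (!₁ η ⊗₁ !₁ η)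
            ≈⟨ pullʳ (pullʳ 𝕋.n-nat) ⟩
          m ∘ ((act (free B) ⊗₁ act (free B′)) ∘ ((T₁ (!₁ η) ⊗₁ T₁ (!₁ η)) ∘ n))
            ≈⟨ refl⟩∘⟨ pullˡ (≈-sym ⊗-∘) ⟩
          m ∘ ((dist ⊗₁ dist) ∘ n) ∎
      ; dist-mK = begin
          !₁ nK ∘ ((act (free K) ∘ T₁ (!₁ η)) ∘ T₁ mK)
            ≈⟨ refl⟩∘⟨ assoc ⟩
          !₁ nK ∘ (act (free K) ∘ (T₁ (!₁ η) ∘ T₁ mK))
            ≈⟨ pullˡ (!-hom nKᵃ) ⟩
          (act A.Kᵀ ∘ T₁ (!₁ nK)) ∘ (T₁ (!₁ η) ∘ T₁ mK)
            ≈⟨ pullʳ T-fuse₃ ⟩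
          act A.Kᵀ ∘ T₁ (!₁ nK ∘ (!₁ η ∘ mK))
            ≈⟨ refl⟩∘⟨ T-resp (cancelˡ (!-resp-inverse 𝕋.η-nK)) ⟩
          act A.Kᵀ ∘ T₁ mK
            ≈⟨ mK-hom ⟨
          mK ∘ nK ∎
      }
      where
      !η-m : ∀ {B B′} → !₁ n ∘ (!₁ η ∘ m) ≈ m ∘ (!₁ (η {B}) ⊗₁ !₁ (η {B′}))
      !η-m = begin
        !₁ n ∘ (!₁ η ∘ m)  ≈⟨ pullˡ !-fuse ⟩
        !₁ (n ∘ η) ∘ m     ≈⟨ !-resp 𝕋.η-n ⟩∘⟨refl ⟩
        !₁ (η ⊗₁ η) ∘ m    ≈⟨ 𝔹.m-nat ⟨
        m ∘ (!₁ η ⊗₁ !₁ η) ∎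

    liftedMCM-distLaw : ∀ 𝔄 → DistLaw⇒Lifts.act! distLaw 𝔄 ≈ act 𝔄
    liftedMCM-distLaw 𝔄 = begin
      !₁ (A.act 𝔄) ∘ (act (free (A.car 𝔄)) ∘ T₁ (!₁ η))
        ≈⟨ pullˡ (!-hom (actᵃ 𝔄)) ⟩
      (act 𝔄 ∘ T₁ (!₁ (A.act 𝔄))) ∘ T₁ (!₁ η)
        ≈⟨ pullʳ (T-resp-inverse (!-resp-inverse (A.IsAlg.alg-η (A.isAlg 𝔄)))) ⟩
      act 𝔄 ∘ id
        ≈⟨ identityʳ ⟩
      act 𝔄 ∎

  distLaw-liftedMCM : ∀ L {B} →
    SymMonMixedDistLaw.dist (LiftedMCM⇒DistLaw.distLaw (DistLaw⇒Lifts.liftedMCM L)) {B}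
      ≈ SymMonMixedDistLaw.dist L {B}
  distLaw-liftedMCM L = begin
    (!₁ μ ∘ dist) ∘ T₁ (!₁ η) ≈⟨ pullʳ dist-nat ⟩
    !₁ μ ∘ (!₁ (T₁ η) ∘ dist) ≈⟨ cancelˡ (!-resp-inverse 𝕋.μ-unitʳ) ⟩
    dist                      ∎
    where open SymMonMixedDistLaw L

  module LiftedSCM⇒DistLaw (Ls : LiftedSCM) where
    open LiftedSCM Ls using (coacts; coact; coact-isCoalg; homs)
    open LiftCHoms homs

    T̃ : C.Coalg → C.Coalg
    T̃ = liftT coacts

    dist : ∀ {B} → T₀ (!₀ B) ⇒ !₀ (T₀ B)
    dist {B} = !₁ (T₁ ε) ∘ coact (cofree B)

    dist-ε : ∀ {B} → ε ∘ dist {B} ≈ T₁ ε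
    dist-ε {B} = ≈-trans (pullˡ 𝔹.ε-nat) (≈-trans (pullʳ coalg-ε) identityʳ)
      where open C.IsCoalg (coact-isCoalg (cofree B))

    distᶜ : ∀ {B} → C.CoalgHom (T̃ (cofree B)) (cofree (T₀ B))
    distᶜ {B} = C.coalgHom dist (begin
      δ ∘ (!₁ (T₁ ε) ∘ coact (cofree B))
        ≈⟨ pullˡ 𝔹.δ-nat ⟩
      (!₁ (!₁ (T₁ ε)) ∘ δ) ∘ coact (cofree B)
        ≈⟨ pullʳ (C.IsCoalg.coalg-δ (coact-isCoalg (cofree B))) ⟩
      !₁ (!₁ (T₁ ε)) ∘ (!₁ (coact (cofree B)) ∘ coact (cofree B))
        ≈⟨ pullˡ !-fuse ⟩
      !₁ dist ∘ coact (cofree B) ∎)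

    distLaw : SymMonMixedDistLaw
    distLaw = record
      { dist = dist
      ; dist-nat = λ {B} {B′} {f} → begin
          (!₁ (T₁ ε) ∘ coact (cofree B′)) ∘ T₁ (!₁ f)
            ≈⟨ pullʳ (T-hom (!₁ᶜ f)) ⟩
          !₁ (T₁ ε) ∘ (!₁ (T₁ (!₁ f)) ∘ coact (cofree B))
            ≈⟨ pullˡ (!-resp-square (T-resp-square 𝔹.ε-nat)) ⟩
          (!₁ (T₁ f) ∘ !₁ (T₁ ε)) ∘ coact (cofree B)
            ≈⟨ assoc ⟩
          !₁ (T₁ f) ∘ dist ∎
      ; dist-μ = λ {B} → begin
          (!₁ (T₁ ε) ∘ coact (cofree B)) ∘ μ
            ≈⟨ pullʳ (μ-hom (cofree B)) ⟩
          !₁ (T₁ ε) ∘ (!₁ μ ∘ coact (T̃ (cofree B)))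
            ≈⟨ pullˡ (!-resp-square Tε-μ) ⟩
          (!₁ μ ∘ !₁ (T₁ (ε ∘ dist))) ∘ coact (T̃ (cofree B))
            ≈⟨ pullʳ (pushˡ (≈-trans (!-resp T-split) !-split)) ⟩
          !₁ μ ∘ (!₁ (T₁ ε) ∘ (!₁ (T₁ dist) ∘ coact (T̃ (cofree B))))
            ≈⟨ refl⟩∘⟨ refl⟩∘⟨ T-hom distᶜ ⟨
          !₁ μ ∘ (!₁ (T₁ ε) ∘ (coact (cofree (T₀ B)) ∘ T₁ dist))
            ≈⟨ refl⟩∘⟨ sym-assoc ⟩
          !₁ μ ∘ (dist ∘ T₁ dist) ∎
      ; dist-η = λ {B} → begin
          (!₁ (T₁ ε) ∘ coact (cofree B)) ∘ η ≈⟨ pullʳ (η-hom (cofree B)) ⟩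
          !₁ (T₁ ε) ∘ (!₁ η ∘ δ)             ≈⟨ pullˡ (!-resp-square (≈-sym 𝕋.η-nat)) ⟩
          (!₁ η ∘ !₁ ε) ∘ δ                  ≈⟨ pullʳ 𝔹.δ-unitʳ ⟩
          !₁ η ∘ id                          ≈⟨ identityʳ ⟩
          !₁ η                               ∎
      ; dist-δ = λ {B} → ≈-trans (C.comm distᶜ) (refl⟩∘⟨ ≈-sym (begin
          (!₁ (T₁ ε) ∘ coact (cofree (!₀ B))) ∘ T₁ δ
            ≈⟨ pullʳ (T-hom δᶜ) ⟩
          !₁ (T₁ ε) ∘ (!₁ (T₁ δ) ∘ coact (cofree B))
            ≈⟨ cancelˡ (!-resp-inverse (T-resp-inverse 𝔹.δ-unitˡ)) ⟩
          coact (cofree B) ∎))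
      ; dist-ε = dist-ε
      ; dist-m = λ {B} {B′} → begin
          !₁ n ∘ ((!₁ (T₁ ε) ∘ coact (cofree (B ⊗₀ B′))) ∘ T₁ m)
            ≈⟨ refl⟩∘⟨ pullʳ (T-hom mᶜ) ⟩
          !₁ n ∘ (!₁ (T₁ ε) ∘ (!₁ (T₁ m) ∘ coact (cofree B C.⊗ᶜ cofree B′)))
            ≈⟨ pull₃ !-fuse₃ ⟩
          !₁ (n ∘ (T₁ ε ∘ T₁ m)) ∘ coact (cofree B C.⊗ᶜ cofree B′)
            ≈⟨ !-resp n-Tε-m ⟩∘⟨refl ⟩
          !₁ ((T₁ ε ⊗₁ T₁ ε) ∘ n) ∘ coact (cofree B C.⊗ᶜ cofree B′)
            ≈⟨ pushˡ !-split ⟩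
          !₁ (T₁ ε ⊗₁ T₁ ε) ∘ (!₁ n ∘ coact (cofree B C.⊗ᶜ cofree B′))
            ≈⟨ refl⟩∘⟨ n-hom (cofree B) (cofree B′) ⟨
          !₁ (T₁ ε ⊗₁ T₁ ε) ∘ ((m ∘ (coact (cofree B) ⊗₁ coact (cofree B′))) ∘ n)
            ≈⟨ refl⟩∘⟨ assoc ⟩
          !₁ (T₁ ε ⊗₁ T₁ ε) ∘ (m ∘ ((coact (cofree B) ⊗₁ coact (cofree B′)) ∘ n))
            ≈⟨ pullˡ (≈-sym 𝔹.m-nat) ⟩
          (m ∘ (!₁ (T₁ ε) ⊗₁ !₁ (T₁ ε))) ∘ ((coact (cofree B) ⊗₁ coact (cofree B′)) ∘ n)
            ≈⟨ pullʳ (pullˡ (≈-sym ⊗-∘)) ⟩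
          m ∘ ((dist ⊗₁ dist) ∘ n) ∎
      ; dist-mK = begin
          !₁ nK ∘ ((!₁ (T₁ ε) ∘ coact (cofree K)) ∘ T₁ mK)
            ≈⟨ refl⟩∘⟨ pullʳ (T-hom mKᶜ) ⟩
          !₁ nK ∘ (!₁ (T₁ ε) ∘ (!₁ (T₁ mK) ∘ coact C.Kᶜ))
            ≈⟨ pull₃ !-fuse₃ ⟩
          !₁ (nK ∘ (T₁ ε ∘ T₁ mK)) ∘ coact C.Kᶜ
            ≈⟨ !-resp (elimʳ (T-resp-inverse 𝔹.ε-mK)) ⟩∘⟨refl ⟩
          !₁ nK ∘ coact C.Kᶜ
            ≈⟨ nK-hom ⟨
          mK ∘ nK ∎
      }
      where
      Tε-μ : ∀ {B} → T₁ (ε {B}) ∘ μ ≈ μ ∘ T₁ (ε ∘ dist)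
      Tε-μ = ≈-trans (≈-sym 𝕋.μ-nat) (refl⟩∘⟨ T-resp (≈-sym dist-ε))

      n-Tε-m : ∀ {B B′} → n ∘ (T₁ ε ∘ T₁ m) ≈ (T₁ (ε {B}) ⊗₁ T₁ (ε {B′})) ∘ n
      n-Tε-m = ≈-trans (refl⟩∘⟨ ≈-trans T-fuse (T-resp 𝔹.ε-m)) 𝕋.n-nat

    liftedSCM-distLaw : ∀ ℭ → DistLaw⇒Lifts.coactᵀ distLaw ℭ ≈ coact ℭ
    liftedSCM-distLaw ℭ = begin
      (!₁ (T₁ ε) ∘ coact (cofree (C.car ℭ))) ∘ T₁ (C.coact ℭ)
        ≈⟨ pullʳ (T-hom (coactᶜ ℭ)) ⟩
      !₁ (T₁ ε) ∘ (!₁ (T₁ (C.coact ℭ)) ∘ coact ℭ)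
        ≈⟨ cancelˡ (!-resp-inverse (T-resp-inverse (C.IsCoalg.coalg-ε (C.isCoalg ℭ)))) ⟩
      coact ℭ ∎

  distLaw-liftedSCM : ∀ L {B} →
    SymMonMixedDistLaw.dist (LiftedSCM⇒DistLaw.distLaw (DistLaw⇒Lifts.liftedSCM L)) {B}
      ≈ SymMonMixedDistLaw.dist L {B}
  distLaw-liftedSCM L = begin
    !₁ (T₁ ε) ∘ (dist ∘ T₁ δ) ≈⟨ pullˡ (≈-sym dist-nat) ⟩
    (dist ∘ T₁ (!₁ ε)) ∘ T₁ δ ≈⟨ pullʳ (T-resp-inverse 𝔹.δ-unitʳ) ⟩
    dist ∘ id                 ≈⟨ identityʳ ⟩
    dist                      ∎
    where open SymMonMixedDistLaw L

  DistLaw≅LiftedMCM : Inverse DistLaw-setoid LiftedMCM-setoid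
  DistLaw≅LiftedMCM = record
    { to = DistLaw⇒Lifts.liftedMCM
    ; from = LiftedMCM⇒DistLaw.distLaw
    ; to-cong = λ p 𝔄 → refl⟩∘⟨ p
    ; from-cong = λ p → p _ ⟩∘⟨refl
    ; inverse = (λ {Lm} p 𝔄 → ≈-trans (refl⟩∘⟨ p) (LiftedMCM⇒DistLaw.liftedMCM-distLaw Lm 𝔄))
              , (λ {L} p → ≈-trans (p _ ⟩∘⟨refl) (distLaw-liftedMCM L))
    }

  DistLaw≅LiftedSCM : Inverse DistLaw-setoid LiftedSCM-setoid
  DistLaw≅LiftedSCM = record
    { to = DistLaw⇒Lifts.liftedSCM
    ; from = LiftedSCM⇒DistLaw.distLaw
    ; to-cong = λ p ℭ → p ⟩∘⟨refl
    ; from-cong = λ p → refl⟩∘⟨ p _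
    ; inverse = (λ {Ls} p ℭ → ≈-trans (p ⟩∘⟨refl) (LiftedSCM⇒DistLaw.liftedSCM-distLaw Ls ℭ))
              , (λ {L} p → ≈-trans (refl⟩∘⟨ p _) (distLaw-liftedSCM L))
    }

proposition6p5 : ∀ {o ℓ r} (X : SymMonCat o ℓ r)
    (𝕋 : SymComonoidalMonad X) (𝔹 : MonoidalCoalgebraModality X) →
    Inverse (Correspondence.DistLaw-setoid X 𝕋 𝔹) (Correspondence.LiftedMCM-setoid X 𝕋 𝔹)
    × Inverse (Correspondence.DistLaw-setoid X 𝕋 𝔹) (Correspondence.LiftedSCM-setoid X 𝕋 𝔹)
proposition6p5 X 𝕋 𝔹 = DistLaw≅LiftedMCM , DistLaw≅LiftedSCM
  where open Bijections X 𝕋 𝔹
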